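{- The map $\alpha:\mathsf{T}_n\cup\{\varnothing\}\to B_n^{[n-1]}$, $I\mapsto w_{g(I)}$, is an isomorphism of posets, where $B_n^{[n-1]}$ carries the Bruhat order.
   Context: Tableau order: for nonempty $A,B\subseteq[n]$, $A\sqsubseteq B$ iff $\#A\ge\#B$ and $A(k)\le B(k)$ for all $k\le\#B$ ($A(k)$ the $k$-th smallest element), i.e. $A,B$ are the columns of a two-column semistandard tableau; moreover $A\sqsubseteq\varnothing$ for all $A\subseteq[n]$. $\mathsf{T}_n$ is the set of nonempty subsets of $[n]$ with this order, and $\mathsf{T}_n\cup\{\varnothing\}$ has $\varnothing$ adjoined as top element. $B_n$ is the Coxeter group with generators $s_0,\dots,s_{n-1}$ and relations $s_j^2=1$, $(s_0s_1)^4=1$, $(s_is_{i+1})^3=1$ for $i\in[n-2]$, $(s_js_k)^2=1$ for $|j-k|\ge2$; $\ell$ is its length function and $\le$ its Bruhat order (subword property). $B_n^{[n-1]}=\{w\in B_n:\ell(w)<\ell(ws_i)\ \forall i\in[n-1]\}$ with the restricted Bruhat order. Let $w_1=s_0$, $w_{k+1}=s_kw_k$ for $k\in[n-1]$, and $w_I=w_{i_1}\cdots w_{i_m}$ for $I=\{i_1<\cdots<i_m\}\subseteq[n]$ ($w_\varnothing=1$). $g(I)=\{n-j+1:j\in[n]\setminus I\}$. -}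

module Defs where

open import Data.Nat using (ℕ; zero; suc; _+_; _≤_; _<_)
open import Data.Nat.Properties using (<⇒≤)
open import Data.Bool using (Bool; true; false; not)
open import Data.Fin using (Fin; toℕ; fromℕ<; opposite)
open import Data.Fin.Properties using (toℕ<n)
open import Data.Fin.Subset using (Subset)
open import Data.Vec using (Vec; []; _∷_; lookup; tabulate)
open import Data.List using (List; []; _∷_; _++_; length; map; concatMap; [_])
open import Data.List.Relation.Binary.Sublist.Propositional using (_⊆_)
open import Data.Product using (Σ; ∃; _×_; _,_)
open import Data.Sum using (_⊎_)
open import Data.Empty using (⊥)
open import Relation.Binary.PropositionalEquality using (_≡_)

-- Subsets of [n] = {1,…,n}.  A subset is a `Subset n` (Vec Bool n);
-- position i : Fin n stands for the number toℕ i + 1 ∈ [n].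

elemsF : ∀ {n} → Subset n → List (Fin n)
elemsF [] = []
elemsF (true  ∷ bs) = Fin.zero ∷ map Fin.suc (elemsF bs)
elemsF (false ∷ bs) = map Fin.suc (elemsF bs)

elems : ∀ {n} → Subset n → List ℕ
elems A = map (λ i → suc (toℕ i)) (elemsF A)

-- k-th entry of a list (0-based; default 0 out of range, never used there)
kth : List ℕ → ℕ → ℕ
kth []       _       = 0
kth (x ∷ xs) zero    = x
kth (x ∷ xs) (suc k) = kth xs k

-- Tableau order on T_n ∪ {∅} (∅ adjoined as top):
--   A ⊑ ∅ for every A;
--   for B nonempty, A ⊑ B iff A nonempty, #A ≥ #B and A(k) ≤ B(k) for k ≤ #B.
_⊑_ : ∀ {n} → Subset n → Subset n → Set
A ⊑ B = (elems B ≡ [])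
      ⊎ ((elems A ≡ [] → ⊥)
         × length (elems B) ≤ length (elems A)
         × (∀ k → k < length (elems B) → kth (elems A) k ≤ kth (elems B) k))

-- g(I) = { n - j + 1 : j ∈ [n] \ I }.
-- Position p (number p+1) is in g(I) iff the number n - (p+1) + 1 = n - p,
-- i.e. position `opposite p` (= n-1-p), is NOT in I.
g : ∀ {n} → Subset n → Subset n
g {n} I = tabulate (λ p → not (lookup I (opposite p)))

-- The Coxeter group B_n, presented by generators s_0,…,s_{n-1}
-- (letters Fin n, letter i ↦ s_{toℕ i}) and the given relations.
-- Since all generators are involutions, group elements are words in the
-- generators modulo the congruence generated by the relations.

Word : ℕ → Set
Word n = List (Fin n)

data Relator {n : ℕ} : Word n → Set where
  invol : (j : Fin n) → Relator (j ∷ j ∷ [])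
  br4   : (a b : Fin n) → toℕ a ≡ 0 → toℕ b ≡ 1 →
          Relator (a ∷ b ∷ a ∷ b ∷ a ∷ b ∷ a ∷ b ∷ [])
  br3   : (a b : Fin n) → 1 ≤ toℕ a → toℕ b ≡ suc (toℕ a) →
          Relator (a ∷ b ∷ a ∷ b ∷ a ∷ b ∷ [])
  comm  : (a b : Fin n) → (2 + toℕ a ≤ toℕ b ⊎ 2 + toℕ b ≤ toℕ a) →
          Relator (a ∷ b ∷ a ∷ b ∷ [])

data _≈_ {n : ℕ} : Word n → Word n → Set where
  rel    : (u v r : Word n) → Relator r → (u ++ r ++ v) ≈ (u ++ v)
  ≈refl  : {u : Word n} → u ≈ u
  ≈sym   : {u v : Word n} → u ≈ v → v ≈ u
  ≈trans : {u v w : Word n} → u ≈ v → v ≈ w → u ≈ w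

HasLength : ∀ {n} → Word n → ℕ → Set
HasLength w k = (∃ λ a → a ≈ w × length a ≡ k)
              × (∀ a → a ≈ w → k ≤ length a)

Reduced : ∀ {n} → Word n → Set
Reduced a = ∀ b → b ≈ a → length a ≤ length b

-- Bruhat order via the subword property: u ≤ w iff some reduced expression
-- of w contains a subword which is a reduced expression of u.
_≤B_ : ∀ {n} → Word n → Word n → Set
u ≤B w = ∃ λ a → a ≈ w × Reduced a × ∃ λ b → b ⊆ a × Reduced b × b ≈ u

-- w ∈ B_n^{[n-1]} : ℓ(w) < ℓ(w s_i) for all i ∈ [n-1]
InQuot : ∀ {n} → Word n → Set
InQuot {n} w = (i : Fin n) → 1 ≤ toℕ i → ∀ k m →
               HasLength w k → HasLength (w ++ [ i ]) m → k < m

down : ∀ {n} (k : ℕ) → k ≤ n → Word n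
down zero    _ = []
down (suc k) p = fromℕ< p ∷ down k (<⇒≤ p)

-- w_k for k = toℕ i + 1 ∈ [n]:  w_1 = s_0, w_{k+1} = s_k w_k
wk : ∀ {n} → Fin n → Word n
wk i = down (suc (toℕ i)) (toℕ<n i)

wSet : ∀ {n} → Subset n → Word n
wSet I = concatMap wk (elemsF I)

α : ∀ {n} → Subset n → Word n
α I = wSet (g I)

-- B_n acts on lists by signed permutations: s_0 negates the first entry, s_k swaps the entries
-- k-1 and k.  Acting on the all-positive list of length n, a word yields a set of negated positions
-- whose weight Σ (p+1) grows by at most one per letter, so it bounds the length from below.  The
-- word w_G yields exactly G and its length is this weight, so w_G is reduced and α is injective.
-- The s_i with i ≥ 1 fix the all-positive list and relations have even length, hence
-- ℓ(w_G s_i) > ℓ(w_G).  Along a reduced word each letter moves one negated entry one step outward,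
-- so a subword has dominated counts of negated positions beyond every t; conversely such dominance
-- embeds w_G into w_H block by block.  For the sets g(I), g(J) this dominance is exactly the
-- tableau order I ⊑ J.  Finally, every element has a normal form, a product of minimal coset
-- representatives for B_1 ⊂ B_2 ⊂ ⋯ ⊂ B_n, which is unique (acting on distinctly labelled entries
-- recovers it) and hence of minimal length; a normal form without a right descent s_i, i ≥ 1, is
-- a word w_G.

module Submission where

open import Defs
open import Data.Nat using (ℕ; zero; suc; _+_; _∸_; _⊓_; _≤_; _<_; z≤n; s≤s; _≡ᵇ_; _≤?_; _<?_; _≟_)
open import Data.Nat.Properties
open import Data.Bool using (Bool; true; false; not; if_then_else_)
open import Data.Bool.Properties using (not-involutive; not-¬)
open import Data.Fin using (Fin; toℕ; fromℕ<; fromℕ; inject₁; opposite)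
import Data.Fin as Fin
open import Data.Fin.Subset using (Subset)
open import Data.Vec using (Vec; []; _∷_; toList; fromList; lookup; tabulate)
open import Data.Vec.Properties using (toList-injective; tabulate-cong; cast-is-id; length-toList; toList∘fromList)
open import Data.Fin.Properties using (toℕ<n; toℕ-fromℕ<; toℕ-injective)
open import Data.List using (List; []; _∷_; _++_; length; map; [_]; reverse; replicate; drop; take; concatMap; filter)
open import Data.List.Properties using (++-assoc; ++-identityʳ; length-++; map-++; unfold-reverse; length-replicate; length-map;
  drop-all; take-all; length-take; length-reverse; reverse-map; reverse-involutive; map-∘; map-cong; map-id;
  map-injective; filter-accept; filter-reject; filter-all; length-filter)
open import Data.List.Relation.Unary.All using (All; []; _∷_)
import Data.List.Relation.Unary.All as All
import Data.List.Relation.Unary.All.Properties as All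
open import Data.List.Relation.Unary.AllPairs using (AllPairs; []; _∷_)
import Data.List.Relation.Unary.AllPairs as AllPairs
import Data.List.Relation.Unary.AllPairs.Properties as AllPairs
open import Data.List.Relation.Binary.Sublist.Propositional using (_⊆_; []; _∷_; _∷ʳ_; ⊆-reflexive)
open import Data.List.Relation.Binary.Sublist.Propositional.Properties using (++⁺; ++⁺ˡ)
open import Data.Maybe using (Maybe; just; nothing)
import Data.Maybe as Maybe
open import Data.Maybe.Properties using (just-injective)
open import Data.Product using (∃; ∃₂; _×_; _,_; proj₁; proj₂)
open import Data.Sum using (_⊎_; inj₁; inj₂)
open import Data.Empty using (⊥; ⊥-elim)
open import Data.Unit using (⊤; tt)
open import Function using (_∘_)
open import Relation.Nullary using (yes; no)
open import Relation.Binary.Bundles using (Setoid)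
import Relation.Binary.Reasoning.Setoid as SetoidReasoning
open import Relation.Binary.Definitions using (tri<; tri≈; tri>)
open import Level using (0ℓ)
open import Relation.Binary.PropositionalEquality hiding ([_])

-- The congruence _≈_

Far : ℕ → ℕ → Set
Far i j = 2 + i ≤ j ⊎ 2 + j ≤ i

Far-sym : ∀ {i j} → Far i j → Far j i
Far-sym (inj₁ p) = inj₂ p
Far-sym (inj₂ p) = inj₁ p

module _ {n : ℕ} where

  ≈-subst : {a b c d : Word n} → a ≡ c → b ≡ d → a ≈ b → c ≈ d
  ≈-subst refl refl p = p

  ≈-inside : {a b : Word n} (u v : Word n) → a ≈ b → (u ++ a ++ v) ≈ (u ++ b ++ v)
  ≈-inside u v (rel u′ v′ r r-rel) =
    ≈-subst (trans (cong ((u ++ u′) ++_) (sym (++-assoc r v′ v))) (reassoc (r ++ v′)))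
            (reassoc v′) (rel (u ++ u′) (v′ ++ v) r r-rel)
    where
    reassoc : ∀ w → (u ++ u′) ++ w ++ v ≡ u ++ (u′ ++ w) ++ v
    reassoc w = trans (++-assoc u u′ (w ++ v)) (cong (u ++_) (sym (++-assoc u′ w v)))
  ≈-inside u v ≈refl = ≈refl
  ≈-inside u v (≈sym p) = ≈sym (≈-inside u v p)
  ≈-inside u v (≈trans p q) = ≈trans (≈-inside u v p) (≈-inside u v q)

  ≈-++⁺ˡ : {a b : Word n} (u : Word n) → a ≈ b → (u ++ a) ≈ (u ++ b)
  ≈-++⁺ˡ {a} {b} u p =
    ≈-subst (cong (u ++_) (++-identityʳ a)) (cong (u ++_) (++-identityʳ b)) (≈-inside u [] p)

  ≈-++⁺ʳ : {a b : Word n} (v : Word n) → a ≈ b → (a ++ v) ≈ (b ++ v)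
  ≈-++⁺ʳ v p = ≈-inside [] v p

  relator≈[] : (r : Word n) → Relator r → r ≈ []
  relator≈[] r r-rel = ≈-subst (++-identityʳ r) refl (rel [] [] r r-rel)

  involution : (a : Fin n) → (a ∷ a ∷ []) ≈ []
  involution a = relator≈[] _ (invol a)

  ++-reverse≈[] : (q : Word n) → (q ++ reverse q) ≈ []
  ++-reverse≈[] [] = ≈refl
  ++-reverse≈[] (x ∷ q) =
    ≈-subst (cong (x ∷_) (trans (++-assoc q (reverse q) [ x ]) (cong (q ++_) (sym (unfold-reverse x q)))))
            refl
            (≈trans (≈-inside [ x ] [ x ] (++-reverse≈[] q)) (involution x))

  ++≈[]⇒≈reverse : (p q : Word n) → (p ++ q) ≈ [] → p ≈ reverse q
  ++≈[]⇒≈reverse p q pq≈[] =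
    ≈trans (≈-subst (++-identityʳ p) refl (≈-++⁺ˡ p (≈sym (++-reverse≈[] q))))
           (≈-subst (++-assoc p q (reverse q)) refl (≈-++⁺ʳ (reverse q) pq≈[]))

  commute : (a b : Fin n) → Far (toℕ a) (toℕ b) → (a ∷ b ∷ []) ≈ (b ∷ a ∷ [])
  commute a b far = ++≈[]⇒≈reverse (a ∷ b ∷ []) (a ∷ b ∷ []) (relator≈[] _ (comm a b far))

  braid₃ : (a b : Fin n) → 1 ≤ toℕ a → toℕ b ≡ suc (toℕ a) → (a ∷ b ∷ a ∷ []) ≈ (b ∷ a ∷ b ∷ [])
  braid₃ a b 1≤a b≡1+a = ++≈[]⇒≈reverse (a ∷ b ∷ a ∷ []) (b ∷ a ∷ b ∷ []) (relator≈[] _ (br3 a b 1≤a b≡1+a))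

  braid₄ : (a b : Fin n) → toℕ a ≡ 0 → toℕ b ≡ 1 → (a ∷ b ∷ a ∷ b ∷ []) ≈ (b ∷ a ∷ b ∷ a ∷ [])
  braid₄ a b a≡0 b≡1 = ++≈[]⇒≈reverse (a ∷ b ∷ a ∷ b ∷ []) (a ∷ b ∷ a ∷ b ∷ []) (relator≈[] _ (br4 a b a≡0 b≡1))

-- B_n acting on lists by signed permutations

module SignedAction {A : Set} (neg : A → A) where

  negateHead : List A → List A
  negateHead [] = []
  negateHead (x ∷ xs) = neg x ∷ xs

  swap : ℕ → List A → List A
  swap zero [] = []
  swap zero (x ∷ []) = x ∷ []
  swap zero (x ∷ y ∷ xs) = y ∷ x ∷ xs
  swap (suc k) [] = []
  swap (suc k) (x ∷ xs) = x ∷ swap k xs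

  gen : ℕ → List A → List A
  gen zero = negateHead
  gen (suc k) = swap k

  actℕ : List ℕ → List A → List A
  actℕ [] x = x
  actℕ (c ∷ w) x = gen c (actℕ w x)

  act : ∀ {n} → Word n → List A → List A
  act w = actℕ (map toℕ w)

  actℕ-++ : ∀ u v x → actℕ (u ++ v) x ≡ actℕ u (actℕ v x)
  actℕ-++ [] v x = refl
  actℕ-++ (c ∷ u) v x = cong (gen c) (actℕ-++ u v x)

  act-++ : ∀ {n} (u v : Word n) x → act (u ++ v) x ≡ act u (act v x)
  act-++ u v x = trans (cong (λ w → actℕ w x) (map-++ toℕ u v)) (actℕ-++ (map toℕ u) (map toℕ v) x)

  length-swap : ∀ k x → length (swap k x) ≡ length x
  length-swap zero [] = refl
  length-swap zero (x ∷ []) = refl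
  length-swap zero (x ∷ y ∷ xs) = refl
  length-swap (suc k) [] = refl
  length-swap (suc k) (x ∷ xs) = cong suc (length-swap k xs)

  length-gen : ∀ c x → length (gen c x) ≡ length x
  length-gen zero [] = refl
  length-gen zero (x ∷ xs) = refl
  length-gen (suc k) = length-swap k

  length-actℕ : ∀ w x → length (actℕ w x) ≡ length x
  length-actℕ [] x = refl
  length-actℕ (c ∷ w) x = trans (length-gen c (actℕ w x)) (length-actℕ w x)

  swap-involutive : ∀ k x → swap k (swap k x) ≡ x
  swap-involutive zero [] = refl
  swap-involutive zero (x ∷ []) = refl
  swap-involutive zero (x ∷ y ∷ xs) = refl
  swap-involutive (suc k) [] = refl
  swap-involutive (suc k) (x ∷ xs) = cong (x ∷_) (swap-involutive k xs)

  swap-comm : ∀ j k x → 2 + j ≤ k → swap j (swap k x) ≡ swap k (swap j x)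
  swap-comm zero (suc zero) x (s≤s ())
  swap-comm zero (suc (suc k)) [] _ = refl
  swap-comm zero (suc (suc k)) (a ∷ []) _ = refl
  swap-comm zero (suc (suc k)) (a ∷ b ∷ xs) _ = refl
  swap-comm (suc j) (suc k) [] _ = refl
  swap-comm (suc j) (suc k) (a ∷ xs) (s≤s p) = cong (a ∷_) (swap-comm j k xs p)

  negateHead-swap-comm : ∀ k x → negateHead (swap (suc k) x) ≡ swap (suc k) (negateHead x)
  negateHead-swap-comm k [] = refl
  negateHead-swap-comm k (a ∷ xs) = refl

  swap-braid : ∀ k x → 3 + k ≤ length x →
    swap k (swap (suc k) (swap k (swap (suc k) (swap k (swap (suc k) x))))) ≡ x
  swap-braid zero (a ∷ b ∷ c ∷ xs) _ = refl
  swap-braid zero (a ∷ []) (s≤s ())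
  swap-braid zero (a ∷ b ∷ []) (s≤s (s≤s ()))
  swap-braid (suc k) (a ∷ xs) (s≤s p) = cong (a ∷_) (swap-braid k xs p)

  module _ (neg-involutive : ∀ x → neg (neg x) ≡ x) where

    gen-involutive : ∀ c x → gen c (gen c x) ≡ x
    gen-involutive zero [] = refl
    gen-involutive zero (x ∷ xs) = cong (_∷ xs) (neg-involutive x)
    gen-involutive (suc k) = swap-involutive k

    negateHead-swap-braid : ∀ x → 2 ≤ length x →
      negateHead (swap 0 (negateHead (swap 0 (negateHead (swap 0 (negateHead (swap 0 x))))))) ≡ x
    negateHead-swap-braid (a ∷ b ∷ xs) _ = cong₂ (λ u v → u ∷ v ∷ xs) (neg-involutive a) (neg-involutive b)
    negateHead-swap-braid (a ∷ []) (s≤s ())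

    gen-comm : ∀ a b x → 2 + a ≤ b → gen a (gen b x) ≡ gen b (gen a x)
    gen-comm zero (suc zero) x (s≤s ())
    gen-comm zero (suc (suc k)) x _ = negateHead-swap-comm k x
    gen-comm (suc j) (suc k) x (s≤s p) = swap-comm j k x p

    commuting⇒abab : ∀ a b x → gen a (gen b x) ≡ gen b (gen a x) → gen a (gen b (gen a (gen b x))) ≡ x
    commuting⇒abab a b x ab≡ba = begin
      gen a (gen b (gen a (gen b x))) ≡⟨ cong (λ z → gen a (gen b z)) ab≡ba ⟩
      gen a (gen b (gen b (gen a x))) ≡⟨ cong (gen a) (gen-involutive b (gen a x)) ⟩
      gen a (gen a x)                 ≡⟨ gen-involutive a x ⟩
      x                               ∎
      where open ≡-Reasoning

    act-relator : ∀ {n} (r : Word n) → Relator r → ∀ x → length x ≡ n → act r x ≡ x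
    act-relator _ (invol j) x _ = gen-involutive (toℕ j) x
    act-relator _ (br4 a b a≡0 b≡1) x refl rewrite a≡0 | b≡1 =
      negateHead-swap-braid x (subst (_< length x) b≡1 (toℕ<n b))
    act-relator _ (br3 a b 1≤a b≡1+a) x refl with toℕ a | b≡1+a
    ... | suc t | b≡2+t rewrite b≡2+t = swap-braid t x (subst (_< length x) b≡2+t (toℕ<n b))
    act-relator _ (comm a b (inj₁ p)) x _ = commuting⇒abab (toℕ a) (toℕ b) x (gen-comm (toℕ a) (toℕ b) x p)
    act-relator _ (comm a b (inj₂ p)) x _ = commuting⇒abab (toℕ a) (toℕ b) x (sym (gen-comm (toℕ b) (toℕ a) x p))

    ≈⇒act≡ : ∀ {n} {u v : Word n} → u ≈ v → ∀ x → length x ≡ n → act u x ≡ act v x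
    ≈⇒act≡ (rel u v r r-rel) x lx = begin
      act (u ++ r ++ v) x     ≡⟨ act-++ u (r ++ v) x ⟩
      act u (act (r ++ v) x)  ≡⟨ cong (act u) (act-++ r v x) ⟩
      act u (act r (act v x)) ≡⟨ cong (act u) (act-relator r r-rel (act v x) (trans (length-actℕ (map toℕ v) x) lx)) ⟩
      act u (act v x)         ≡⟨ act-++ u v x ⟨
      act (u ++ v) x          ∎
      where open ≡-Reasoning
    ≈⇒act≡ ≈refl x lx = refl
    ≈⇒act≡ (≈sym p) x lx = sym (≈⇒act≡ p x lx)
    ≈⇒act≡ (≈trans p q) x lx = trans (≈⇒act≡ p x lx) (≈⇒act≡ q x lx)

-- Parity of length

even : ℕ → Bool
even zero = true
even (suc zero) = false
even (suc (suc k)) = even k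

even-suc : ∀ k → even (suc k) ≡ not (even k)
even-suc zero = refl
even-suc (suc zero) = refl
even-suc (suc (suc k)) = even-suc k

even-+-inner : ∀ m k l → even k ≡ true → even (m + (k + l)) ≡ even (m + l)
even-+-inner zero zero l _ = refl
even-+-inner zero (suc zero) l ()
even-+-inner zero (suc (suc k)) l even-k = even-+-inner zero k l even-k
even-+-inner (suc m) k l even-k =
  trans (even-suc (m + (k + l))) (trans (cong not (even-+-inner m k l even-k)) (sym (even-suc (m + l))))

even-length-relator : ∀ {n} {r : Word n} → Relator r → even (length r) ≡ true
even-length-relator (invol _) = refl
even-length-relator (br4 _ _ _ _) = refl
even-length-relator (br3 _ _ _ _) = refl
even-length-relator (comm _ _ _) = refl

≈⇒even-length≡ : ∀ {n} {u v : Word n} → u ≈ v → even (length u) ≡ even (length v)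
≈⇒even-length≡ (rel u v r r-rel) rewrite length-++ u {r ++ v} | length-++ r {v} | length-++ u {v} =
  even-+-inner (length u) (length r) (length v) (even-length-relator r-rel)
≈⇒even-length≡ ≈refl = refl
≈⇒even-length≡ (≈sym p) = sym (≈⇒even-length≡ p)
≈⇒even-length≡ (≈trans p q) = trans (≈⇒even-length≡ p) (≈⇒even-length≡ q)

-- Sign patterns, weight and suffix counts

module Sign = SignedAction not

signs : ∀ {n} → Word n → List Bool
signs {n} a = Sign.act a (replicate n false)

≈⇒signs≡ : ∀ {n} {u v : Word n} → u ≈ v → signs u ≡ signs v
≈⇒signs≡ {n} p = Sign.≈⇒act≡ not-involutive p (replicate n false) (length-replicate n)

weight : ℕ → List Bool → ℕ
weight o [] = 0
weight o (b ∷ bs) = (if b then o else 0) + weight (suc o) bs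

weight-replicate-false : ∀ o k → weight o (replicate k false) ≡ 0
weight-replicate-false o zero = refl
weight-replicate-false o (suc k) = weight-replicate-false (suc o) k

weight-swap : ∀ k o x → weight o (Sign.swap k x) ≤ suc (weight o x)
weight-swap zero o [] = z≤n
weight-swap zero o (x ∷ []) = n≤1+n _
weight-swap zero o (false ∷ false ∷ xs) = n≤1+n _
weight-swap zero o (false ∷ true ∷ xs) = ≤-trans (+-monoˡ-≤ (weight (suc (suc o)) xs) (n≤1+n o)) (n≤1+n _)
weight-swap zero o (true ∷ false ∷ xs) = ≤-refl
weight-swap zero o (true ∷ true ∷ xs) = n≤1+n _
weight-swap (suc k) o [] = z≤n
weight-swap (suc k) o (x ∷ xs) =
  ≤-trans (+-monoʳ-≤ (if x then o else 0) (weight-swap k (suc o) xs)) (≤-reflexive (+-suc _ _))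

weight-gen : ∀ c x → weight 1 (Sign.gen c x) ≤ suc (weight 1 x)
weight-gen zero [] = z≤n
weight-gen zero (false ∷ xs) = ≤-refl
weight-gen zero (true ∷ xs) = ≤-trans (n≤1+n _) (n≤1+n _)
weight-gen (suc k) x = weight-swap k 1 x

weight-signs≤length : ∀ {n} (a : Word n) → weight 1 (signs a) ≤ length a
weight-signs≤length {n} [] = ≤-reflexive (weight-replicate-false 1 n)
weight-signs≤length (c ∷ a) = ≤-trans (weight-gen (toℕ c) (signs a)) (s≤s (weight-signs≤length a))

Tight : ∀ {n} → Word n → Set
Tight a = weight 1 (signs a) ≡ length a

Tight-∷⁻ : ∀ {n} (c : Fin n) a → Tight (c ∷ a) →
  Tight a × weight 1 (Sign.gen (toℕ c) (signs a)) ≡ suc (weight 1 (signs a))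
Tight-∷⁻ c a tight = tight-a , ≤-antisym (weight-gen (toℕ c) (signs a)) raise
  where
  tight-a : Tight a
  tight-a = ≤-antisym (weight-signs≤length a) (≤-pred (≤-trans (≤-reflexive (sym tight)) (weight-gen (toℕ c) (signs a))))
  raise : suc (weight 1 (signs a)) ≤ weight 1 (Sign.gen (toℕ c) (signs a))
  raise = ≤-reflexive (trans (cong suc tight-a) (sym tight))

trues : List Bool → ℕ
trues [] = 0
trues (true ∷ xs) = suc (trues xs)
trues (false ∷ xs) = trues xs

suffixTrues : List Bool → ℕ → ℕ
suffixTrues x t = trues (drop t x)

_≼_ : List Bool → List Bool → Set
x ≼ y = ∀ t → suffixTrues x t ≤ suffixTrues y t

indicator : ℕ → ℕ → ℕ
indicator k t = if t ≡ᵇ k then 1 else 0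

trues-swap : ∀ k x → trues (Sign.swap k x) ≡ trues x
trues-swap zero [] = refl
trues-swap zero (x ∷ []) = refl
trues-swap zero (false ∷ false ∷ xs) = refl
trues-swap zero (false ∷ true ∷ xs) = refl
trues-swap zero (true ∷ false ∷ xs) = refl
trues-swap zero (true ∷ true ∷ xs) = refl
trues-swap (suc k) [] = refl
trues-swap (suc k) (false ∷ xs) = trues-swap k xs
trues-swap (suc k) (true ∷ xs) = cong suc (trues-swap k xs)

-- A letter raising the weight by one moves a true one step to the right
-- (or creates one at position 0), so it raises exactly one suffix count.
suffixTrues-swap : ∀ k o x → weight o (Sign.swap k x) ≡ suc (weight o x) →
  ∀ t → suffixTrues (Sign.swap k x) t ≡ indicator (suc k) t + suffixTrues x t
suffixTrues-swap zero o [] () t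
suffixTrues-swap zero o (x ∷ []) raise t = ⊥-elim (1+n≢n (sym raise))
suffixTrues-swap zero o (false ∷ false ∷ xs) raise t = ⊥-elim (1+n≢n (sym raise))
suffixTrues-swap zero o (true ∷ true ∷ xs) raise t = ⊥-elim (1+n≢n (sym raise))
suffixTrues-swap zero o (false ∷ true ∷ xs) raise t = ⊥-elim (<⇒≢ (n≤1+n _) raise)
suffixTrues-swap zero o (true ∷ false ∷ xs) raise zero = refl
suffixTrues-swap zero o (true ∷ false ∷ xs) raise (suc zero) = refl
suffixTrues-swap zero o (true ∷ false ∷ xs) raise (suc (suc t)) = refl
suffixTrues-swap (suc k) o [] () t
suffixTrues-swap (suc k) o (false ∷ xs) raise zero = trues-swap k xs
suffixTrues-swap (suc k) o (true ∷ xs) raise zero = cong suc (trues-swap k xs)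
suffixTrues-swap (suc k) o (x ∷ xs) raise (suc t) =
  suffixTrues-swap k (suc o) xs (+-cancelˡ-≡ (if x then o else 0) _ _ (trans raise (sym (+-suc _ _)))) t

suffixTrues-gen : ∀ c x → weight 1 (Sign.gen c x) ≡ suc (weight 1 x) →
  ∀ t → suffixTrues (Sign.gen c x) t ≡ indicator c t + suffixTrues x t
suffixTrues-gen zero [] () t
suffixTrues-gen zero (true ∷ xs) raise t = ⊥-elim (<⇒≢ (n≤1+n _) raise)
suffixTrues-gen zero (false ∷ xs) raise zero = refl
suffixTrues-gen zero (false ∷ xs) raise (suc t) = refl
suffixTrues-gen (suc k) x raise t = suffixTrues-swap k 1 x raise t

-- Along a tight word each letter raises the weight by one, so suffix counts only grow.
subword⇒signs≼ : ∀ {n} {a b : Word n} → b ⊆ a → Tight a → Tight b → signs b ≼ signs a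
subword⇒signs≼ [] _ _ t = ≤-refl
subword⇒signs≼ {a = c ∷ a} (.c ∷ʳ b⊆a) tight-ca tight-b t with Tight-∷⁻ c a tight-ca
... | tight-a , raise =
  ≤-trans (subword⇒signs≼ b⊆a tight-a tight-b t)
          (≤-trans (m≤n+m _ (indicator (toℕ c) t)) (≤-reflexive (sym (suffixTrues-gen (toℕ c) (signs a) raise t))))
subword⇒signs≼ {a = c ∷ a} {.c ∷ b} (refl ∷ b⊆a) tight-ca tight-cb t with Tight-∷⁻ c a tight-ca | Tight-∷⁻ c b tight-cb
... | tight-a , raise-a | tight-b , raise-b =
  subst₂ _≤_ (sym (suffixTrues-gen (toℕ c) (signs b) raise-b t)) (sym (suffixTrues-gen (toℕ c) (signs a) raise-a t))
         (+-monoʳ-≤ (indicator (toℕ c) t) (subword⇒signs≼ b⊆a tight-a tight-b t))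

-- The words w_G

desc : ℕ → ℕ → List ℕ
desc lo zero = []
desc lo (suc c) = lo + c ∷ desc lo c

asc : ℕ → ℕ → List ℕ
asc lo zero = []
asc lo (suc c) = lo ∷ asc (suc lo) c

-- w_G with letters as numbers, G given by its list of positions
wℕ : List ℕ → List ℕ
wℕ [] = []
wℕ (e ∷ es) = desc 0 (suc e) ++ wℕ es

positions : ∀ {m} → Subset m → List ℕ
positions G = map toℕ (elemsF G)

map-toℕ-suc : ∀ {m} (es : List (Fin m)) → map toℕ (map Fin.suc es) ≡ map suc (map toℕ es)
map-toℕ-suc [] = refl
map-toℕ-suc (e ∷ es) = cong (suc (toℕ e) ∷_) (map-toℕ-suc es)

positions-increasing : ∀ {m} (G : Subset m) → AllPairs _<_ (positions G)
positions-increasing [] = []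
positions-increasing (true ∷ G) rewrite map-toℕ-suc (elemsF G) =
  All.map⁺ (All.universal (λ _ → s≤s z≤n) (positions G)) ∷ AllPairs.map⁺ (AllPairs.map s≤s (positions-increasing G))
positions-increasing (false ∷ G) rewrite map-toℕ-suc (elemsF G) =
  AllPairs.map⁺ (AllPairs.map s≤s (positions-increasing G))

positions-bounded : ∀ {m} (G : Subset m) → All (_< m) (positions G)
positions-bounded G = All.map⁺ (All.universal toℕ<n (elemsF G))

map-toℕ-down : ∀ {n} k (p : k ≤ n) → map toℕ (down k p) ≡ desc 0 k
map-toℕ-down zero p = refl
map-toℕ-down (suc k) p = cong₂ _∷_ (toℕ-fromℕ< p) (map-toℕ-down k (<⇒≤ p))

map-toℕ-wSet : ∀ {n} (G : Subset n) → map toℕ (wSet G) ≡ wℕ (positions G)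
map-toℕ-wSet G = go (elemsF G)
  where
  go : ∀ {n} (es : List (Fin n)) → map toℕ (concatMap wk es) ≡ wℕ (map toℕ es)
  go [] = refl
  go (e ∷ es) = trans (map-++ toℕ (wk e) (concatMap wk es))
                      (cong₂ _++_ (map-toℕ-down (suc (toℕ e)) (toℕ<n e)) (go es))

length-desc : ∀ lo c → length (desc lo c) ≡ c
length-desc lo zero = refl
length-desc lo (suc c) = cong suc (length-desc lo c)

setTrue : ℕ → List Bool → List Bool
setTrue _ [] = []
setTrue zero (x ∷ xs) = true ∷ xs
setTrue (suc k) (x ∷ xs) = x ∷ setTrue k xs

setTrues : List ℕ → List Bool → List Bool
setTrues [] x = x
setTrues (e ∷ es) x = setTrue e (setTrues es x)

FalseUpTo : ℕ → List Bool → Set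
FalseUpTo _ [] = ⊥
FalseUpTo zero (b ∷ _) = b ≡ false
FalseUpTo (suc k) (b ∷ xs) = b ≡ false × FalseUpTo k xs

FalseUpTo-pred : ∀ k x → FalseUpTo (suc k) x → FalseUpTo k x
FalseUpTo-pred zero (b ∷ xs) (b≡false , _) = b≡false
FalseUpTo-pred (suc k) (b ∷ xs) (b≡false , rest) = b≡false , FalseUpTo-pred k xs rest

FalseUpTo-setTrue : ∀ k e x → k < e → FalseUpTo k x → FalseUpTo k (setTrue e x)
FalseUpTo-setTrue zero (suc e) (b ∷ xs) _ f = f
FalseUpTo-setTrue (suc k) (suc e) (b ∷ xs) (s≤s k<e) (b≡false , f) = b≡false , FalseUpTo-setTrue k e xs k<e f

FalseUpTo-setTrues : ∀ k es x → All (k <_) es → FalseUpTo k x → FalseUpTo k (setTrues es x)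
FalseUpTo-setTrues k [] x _ f = f
FalseUpTo-setTrues k (e ∷ es) x (k<e ∷ k<es) f = FalseUpTo-setTrue k e (setTrues es x) k<e (FalseUpTo-setTrues k es x k<es f)

FalseUpTo-replicate : ∀ k m → k < m → FalseUpTo k (replicate m false)
FalseUpTo-replicate zero (suc m) _ = refl
FalseUpTo-replicate (suc k) (suc m) (s≤s k<m) = refl , FalseUpTo-replicate k m k<m

swap-setTrue : ∀ k x → FalseUpTo (suc k) x → Sign.swap k (setTrue k x) ≡ setTrue (suc k) x
swap-setTrue zero (false ∷ false ∷ xs) (refl , refl) = refl
swap-setTrue (suc k) (false ∷ xs) (refl , f) = cong (false ∷_) (swap-setTrue k xs f)

actℕ-desc : ∀ k x → FalseUpTo k x → Sign.actℕ (desc 0 (suc k)) x ≡ setTrue k x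
actℕ-desc zero (false ∷ xs) refl = refl
actℕ-desc (suc k) x f = trans (cong (Sign.swap k) (actℕ-desc k x (FalseUpTo-pred k x f))) (swap-setTrue k x f)

actℕ-wℕ : ∀ m es → AllPairs _<_ es → All (_< m) es →
  Sign.actℕ (wℕ es) (replicate m false) ≡ setTrues es (replicate m false)
actℕ-wℕ m [] _ _ = refl
actℕ-wℕ m (e ∷ es) (e<es ∷ inc) (e<m ∷ es<m) = begin
  Sign.actℕ (desc 0 (suc e) ++ wℕ es) (replicate m false)        ≡⟨ Sign.actℕ-++ (desc 0 (suc e)) (wℕ es) _ ⟩
  Sign.actℕ (desc 0 (suc e)) (Sign.actℕ (wℕ es) (replicate m false)) ≡⟨ cong (Sign.actℕ (desc 0 (suc e))) (actℕ-wℕ m es inc es<m) ⟩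
  Sign.actℕ (desc 0 (suc e)) (setTrues es (replicate m false))    ≡⟨ actℕ-desc e _ (FalseUpTo-setTrues e es _ e<es (FalseUpTo-replicate e m e<m)) ⟩
  setTrue e (setTrues es (replicate m false))                     ∎
  where open ≡-Reasoning

setTrues-map-suc : ∀ es b x → setTrues (map suc es) (b ∷ x) ≡ b ∷ setTrues es x
setTrues-map-suc [] b x = refl
setTrues-map-suc (e ∷ es) b x = cong (setTrue (suc e)) (setTrues-map-suc es b x)

setTrues-positions : ∀ {m} (G : Subset m) → setTrues (positions G) (replicate m false) ≡ toList G
setTrues-positions [] = refl
setTrues-positions {suc m} (true ∷ G) rewrite map-toℕ-suc (elemsF G) =
  trans (cong (setTrue 0) (setTrues-map-suc (positions G) false (replicate m false))) (cong (true ∷_) (setTrues-positions G))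
setTrues-positions {suc m} (false ∷ G) rewrite map-toℕ-suc (elemsF G) =
  trans (setTrues-map-suc (positions G) false (replicate m false)) (cong (false ∷_) (setTrues-positions G))

signs-wSet : ∀ {n} (G : Subset n) → signs (wSet G) ≡ toList G
signs-wSet {n} G = begin
  Sign.actℕ (map toℕ (wSet G)) (replicate n false)   ≡⟨ cong (λ w → Sign.actℕ w (replicate n false)) (map-toℕ-wSet G) ⟩
  Sign.actℕ (wℕ (positions G)) (replicate n false)   ≡⟨ actℕ-wℕ n (positions G) (positions-increasing G) (positions-bounded G) ⟩
  setTrues (positions G) (replicate n false)         ≡⟨ setTrues-positions G ⟩
  toList G                                           ∎
  where open ≡-Reasoning

offsetSum : ℕ → List ℕ → ℕ
offsetSum o [] = 0
offsetSum o (e ∷ es) = (o + e) + offsetSum o es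

offsetSum-map-suc : ∀ o es → offsetSum o (map suc es) ≡ offsetSum (suc o) es
offsetSum-map-suc o [] = refl
offsetSum-map-suc o (e ∷ es) = cong₂ _+_ (+-suc o e) (offsetSum-map-suc o es)

weight-toList : ∀ {m} o (G : Subset m) → weight o (toList G) ≡ offsetSum o (positions G)
weight-toList o [] = refl
weight-toList o (true ∷ G) rewrite map-toℕ-suc (elemsF G) | offsetSum-map-suc o (positions G) | +-identityʳ o =
  cong (o +_) (weight-toList (suc o) G)
weight-toList o (false ∷ G) rewrite map-toℕ-suc (elemsF G) | offsetSum-map-suc o (positions G) =
  weight-toList (suc o) G

length-wℕ : ∀ es → length (wℕ es) ≡ offsetSum 1 es
length-wℕ [] = refl
length-wℕ (e ∷ es) = trans (length-++ (desc 0 (suc e))) (cong₂ _+_ (length-desc 0 (suc e)) (length-wℕ es))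

Tight-wSet : ∀ {n} (G : Subset n) → Tight (wSet G)
Tight-wSet G = begin
  weight 1 (signs (wSet G))         ≡⟨ cong (weight 1) (signs-wSet G) ⟩
  weight 1 (toList G)               ≡⟨ weight-toList 1 G ⟩
  offsetSum 1 (positions G)         ≡⟨ length-wℕ (positions G) ⟨
  length (wℕ (positions G))         ≡⟨ cong length (map-toℕ-wSet G) ⟨
  length (map toℕ (wSet G))         ≡⟨ length-map toℕ (wSet G) ⟩
  length (wSet G)                   ∎
  where open ≡-Reasoning

-- The map g and the tableau order

toList-tabulate-∷ʳ : ∀ {A : Set} {m} (f : Fin (suc m) → A) →
  toList (tabulate f) ≡ toList (tabulate (f ∘ inject₁)) ++ [ f (fromℕ m) ]
toList-tabulate-∷ʳ {m = zero} f = refl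
toList-tabulate-∷ʳ {m = suc m} f = cong (f Fin.zero ∷_) (toList-tabulate-∷ʳ (f ∘ Fin.suc))

opposite-inject₁ : ∀ {m} (q : Fin m) → opposite (inject₁ q) ≡ Fin.suc (opposite q)
opposite-inject₁ {suc m} Fin.zero = refl
opposite-inject₁ {suc m} (Fin.suc q) = cong inject₁ (opposite-inject₁ q)

opposite-fromℕ : ∀ m → opposite (fromℕ m) ≡ Fin.zero
opposite-fromℕ zero = refl
opposite-fromℕ (suc m) = cong inject₁ (opposite-fromℕ m)

toList-g : ∀ {m} (I : Subset m) → toList (g I) ≡ reverse (map not (toList I))
toList-g [] = refl
toList-g {suc m} (b ∷ I) = begin
  toList (g (b ∷ I))                       ≡⟨ toList-tabulate-∷ʳ (λ p → not (lookup (b ∷ I) (opposite p))) ⟩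
  toList (tabulate (λ q → not (lookup (b ∷ I) (opposite (inject₁ q))))) ++ [ not (lookup (b ∷ I) (opposite (fromℕ m))) ]
                                           ≡⟨ cong₂ (λ u v → toList u ++ [ not (lookup (b ∷ I) v) ])
                                                    (tabulate-cong (λ q → cong (λ z → not (lookup (b ∷ I) z)) (opposite-inject₁ q)))
                                                    (opposite-fromℕ m) ⟩
  toList (g I) ++ [ not b ]                ≡⟨ cong (_++ [ not b ]) (toList-g I) ⟩
  reverse (map not (toList I)) ++ [ not b ] ≡⟨ unfold-reverse (not b) (map not (toList I)) ⟨
  reverse (map not (toList (b ∷ I)))       ∎
  where open ≡-Reasoning

toList-injective′ : ∀ {A : Set} {m} {xs ys : Vec A m} → toList xs ≡ toList ys → xs ≡ ys
toList-injective′ {xs = xs} {ys} eq = trans (sym (cast-is-id refl xs)) (toList-injective refl xs ys eq)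

map-not-involutive : ∀ xs → map not (map not xs) ≡ xs
map-not-involutive xs = trans (sym (map-∘ xs)) (trans (map-cong not-involutive xs) (map-id xs))

g-involutive : ∀ {m} (G : Subset m) → g (g G) ≡ G
g-involutive G = toList-injective′ (begin
  toList (g (g G))                                ≡⟨ toList-g (g G) ⟩
  reverse (map not (toList (g G)))                ≡⟨ cong (reverse ∘ map not) (toList-g G) ⟩
  reverse (map not (reverse (map not (toList G)))) ≡⟨ cong reverse (reverse-map not (map not (toList G))) ⟩
  reverse (reverse (map not (map not (toList G)))) ≡⟨ reverse-involutive _ ⟩
  map not (map not (toList G))                    ≡⟨ map-not-involutive (toList G) ⟩
  toList G                                        ∎)
  where open ≡-Reasoning

prefixTrues : List Bool → ℕ → ℕ
prefixTrues x u = trues (take u x)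

_⊴_ : List Bool → List Bool → Set
x ⊴ y = ∀ u → prefixTrues x u ≤ prefixTrues y u

trues-++ : ∀ xs ys → trues (xs ++ ys) ≡ trues xs + trues ys
trues-++ [] ys = refl
trues-++ (true ∷ xs) ys = cong suc (trues-++ xs ys)
trues-++ (false ∷ xs) ys = trues-++ xs ys

drop-++-≤ : ∀ {A : Set} t (xs ys : List A) → t ≤ length xs → drop t (xs ++ ys) ≡ drop t xs ++ ys
drop-++-≤ zero xs ys _ = refl
drop-++-≤ (suc t) (x ∷ xs) ys (s≤s t≤xs) = drop-++-≤ t xs ys t≤xs

suffixTrues-reverse : ∀ z t → suffixTrues (reverse z) t ≡ prefixTrues z (length z ∸ t)
suffixTrues-reverse [] zero = refl
suffixTrues-reverse [] (suc t) = refl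
suffixTrues-reverse (b ∷ z) t with t ≤? length z
... | yes t≤z = begin
  trues (drop t (reverse (b ∷ z)))              ≡⟨ cong (trues ∘ drop t) (unfold-reverse b z) ⟩
  trues (drop t (reverse z ++ [ b ]))           ≡⟨ cong trues (drop-++-≤ t (reverse z) [ b ] (subst (t ≤_) (sym (length-reverse z)) t≤z)) ⟩
  trues (drop t (reverse z) ++ [ b ])           ≡⟨ trues-++ (drop t (reverse z)) [ b ] ⟩
  trues (drop t (reverse z)) + trues [ b ]      ≡⟨ cong (_+ trues [ b ]) (suffixTrues-reverse z t) ⟩
  prefixTrues z (length z ∸ t) + trues [ b ]    ≡⟨ trues-∷ʳ b ⟩
  prefixTrues (b ∷ z) (suc (length z ∸ t))      ≡⟨ cong (prefixTrues (b ∷ z)) (+-∸-assoc 1 t≤z) ⟨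
  prefixTrues (b ∷ z) (suc (length z) ∸ t)      ∎
  where
  open ≡-Reasoning
  trues-∷ʳ : ∀ b → prefixTrues z (length z ∸ t) + trues [ b ] ≡ prefixTrues (b ∷ z) (suc (length z ∸ t))
  trues-∷ʳ true = +-comm _ 1
  trues-∷ʳ false = +-identityʳ _
... | no t≰z = trans (cong trues (drop-all t (reverse (b ∷ z)) (≤-trans (≤-reflexive (length-reverse (b ∷ z))) (≰⇒> t≰z))))
                     (cong (prefixTrues (b ∷ z)) (sym (m≤n⇒m∸n≡0 (≰⇒> t≰z))))

prefixTrues-map-not : ∀ u x → prefixTrues (map not x) u + prefixTrues x u ≡ length (take u x)
prefixTrues-map-not zero x = refl
prefixTrues-map-not (suc u) [] = refl
prefixTrues-map-not (suc u) (true ∷ x) = trans (+-suc _ _) (cong suc (prefixTrues-map-not u x))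
prefixTrues-map-not (suc u) (false ∷ x) = cong suc (prefixTrues-map-not u x)

≤-complement : ∀ a b c d → a + c ≡ b + d → a ≤ b → d ≤ c
≤-complement a b c d a+c≡b+d a≤b =
  +-cancelˡ-≤ a d c (≤-trans (≤-reflexive (+-comm a d)) (≤-trans (+-monoʳ-≤ d a≤b) (≤-reflexive (trans (+-comm d b) (sym a+c≡b+d)))))

module _ {x y : List Bool} (x≡y : length x ≡ length y) (u : ℕ) where

  private
    balance : prefixTrues (map not x) u + prefixTrues x u ≡ prefixTrues (map not y) u + prefixTrues y u
    balance = trans (prefixTrues-map-not u x)
                    (trans (trans (length-take u x) (trans (cong (u ⊓_) x≡y) (sym (length-take u y))))
                           (sym (prefixTrues-map-not u y)))

  prefixTrues-not-≤⇒≥ : prefixTrues (map not x) u ≤ prefixTrues (map not y) u → prefixTrues y u ≤ prefixTrues x u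
  prefixTrues-not-≤⇒≥ = ≤-complement _ _ _ _ balance

  prefixTrues-≥⇒not-≤ : prefixTrues y u ≤ prefixTrues x u → prefixTrues (map not x) u ≤ prefixTrues (map not y) u
  prefixTrues-≥⇒not-≤ = ≤-complement (prefixTrues y u) (prefixTrues x u) (prefixTrues (map not y) u) (prefixTrues (map not x) u)
    (trans (+-comm (prefixTrues y u) _) (trans (sym balance) (+-comm _ (prefixTrues x u))))

suffixTrues-reverse-not : ∀ n x → length x ≡ n → ∀ t → suffixTrues (reverse (map not x)) t ≡ prefixTrues (map not x) (n ∸ t)
suffixTrues-reverse-not n x refl t = trans (suffixTrues-reverse (map not x) t) (cong (λ l → prefixTrues (map not x) (l ∸ t)) (length-map not x))

prefixTrues-∸∸ : ∀ n x → length x ≡ n → ∀ u → prefixTrues x u ≡ prefixTrues x (n ∸ (n ∸ u))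
prefixTrues-∸∸ n x x≡n u with u ≤? n
... | yes u≤n = cong (prefixTrues x) (sym (m∸[m∸n]≡n u≤n))
... | no u≰n = cong trues (trans (take-all u x (≤-trans (≤-reflexive x≡n) (<⇒≤ (≰⇒> u≰n))))
                          (sym (trans (cong (λ k → take (n ∸ k) x) (m≤n⇒m∸n≡0 (<⇒≤ (≰⇒> u≰n)))) (take-all n x (≤-reflexive x≡n)))))

≼-reverse-not⇒⊴ : ∀ n (x y : List Bool) → length x ≡ n → length y ≡ n →
  reverse (map not x) ≼ reverse (map not y) → y ⊴ x
≼-reverse-not⇒⊴ n x y x≡n y≡n ≼ u =
  subst₂ _≤_ (sym (prefixTrues-∸∸ n y y≡n u)) (sym (prefixTrues-∸∸ n x x≡n u))
    (prefixTrues-not-≤⇒≥ (trans x≡n (sym y≡n)) (n ∸ (n ∸ u))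
      (subst₂ _≤_ (suffixTrues-reverse-not n x x≡n (n ∸ u)) (suffixTrues-reverse-not n y y≡n (n ∸ u)) (≼ (n ∸ u))))

⊴⇒≼-reverse-not : ∀ n (x y : List Bool) → length x ≡ n → length y ≡ n →
  y ⊴ x → reverse (map not x) ≼ reverse (map not y)
⊴⇒≼-reverse-not n x y x≡n y≡n ⊴ t =
  subst₂ _≤_ (sym (suffixTrues-reverse-not n x x≡n t)) (sym (suffixTrues-reverse-not n y y≡n t))
    (prefixTrues-≥⇒not-≤ (trans x≡n (sym y≡n)) (n ∸ t) (⊴ (n ∸ t)))

members : List Bool → List ℕ
members [] = []
members (true ∷ x) = 1 ∷ map suc (members x)
members (false ∷ x) = map suc (members x)

elems≡members : ∀ {m} (I : Subset m) → elems I ≡ members (toList I)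
elems≡members [] = refl
elems≡members (true ∷ I) = cong (1 ∷_) (trans (sym (map-∘ (elemsF I))) (trans (map-∘ (elemsF I)) (cong (map suc) (elems≡members I))))
elems≡members (false ∷ I) = trans (sym (map-∘ (elemsF I))) (trans (map-∘ (elemsF I)) (cong (map suc) (elems≡members I)))

length-members : ∀ x → length (members x) ≡ trues x
length-members [] = refl
length-members (true ∷ x) = cong suc (trans (length-map suc (members x)) (length-members x))
length-members (false ∷ x) = trans (length-map suc (members x)) (length-members x)

kth-map-suc : ∀ l k → k < length l → kth (map suc l) k ≡ suc (kth l k)
kth-map-suc (x ∷ l) zero _ = refl
kth-map-suc (x ∷ l) (suc k) (s≤s k<l) = kth-map-suc l k k<l

kth-members-positive : ∀ x k → k < length (members x) → 1 ≤ kth (members x) k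
kth-members-positive (true ∷ x) zero _ = s≤s z≤n
kth-members-positive (true ∷ x) (suc k) (s≤s k<x)
  rewrite kth-map-suc (members x) k (subst (k <_) (length-map suc (members x)) k<x) = s≤s z≤n
kth-members-positive (false ∷ x) k k<x
  rewrite kth-map-suc (members x) k (subst (k <_) (length-map suc (members x)) k<x) = s≤s z≤n

<prefixTrues⇒kth≤ : ∀ x u k → suc k ≤ prefixTrues x u → k < length (members x) × kth (members x) k ≤ u
<prefixTrues⇒kth≤ [] zero k ()
<prefixTrues⇒kth≤ [] (suc u) k ()
<prefixTrues⇒kth≤ (b ∷ x) zero k ()
<prefixTrues⇒kth≤ (true ∷ x) (suc u) zero _ = s≤s z≤n , s≤s z≤n
<prefixTrues⇒kth≤ (true ∷ x) (suc u) (suc k) (s≤s k<x) with <prefixTrues⇒kth≤ x u k k<x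
... | k<members , kth≤u =
  s≤s (subst (k <_) (sym (length-map suc (members x))) k<members) ,
  subst (_≤ suc u) (sym (kth-map-suc (members x) k k<members)) (s≤s kth≤u)
<prefixTrues⇒kth≤ (false ∷ x) (suc u) k k<x with <prefixTrues⇒kth≤ x u k k<x
... | k<members , kth≤u =
  subst (k <_) (sym (length-map suc (members x))) k<members ,
  subst (_≤ suc u) (sym (kth-map-suc (members x) k k<members)) (s≤s kth≤u)

kth≤⇒<prefixTrues : ∀ x u k → k < length (members x) → kth (members x) k ≤ u → suc k ≤ prefixTrues x u
kth≤⇒<prefixTrues [] u k () _
kth≤⇒<prefixTrues (b ∷ x) zero k k<x kth≤0 = ⊥-elim (<-irrefl refl (≤-trans (kth-members-positive (b ∷ x) k k<x) kth≤0))
kth≤⇒<prefixTrues (true ∷ x) (suc u) zero _ _ = s≤s z≤n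
kth≤⇒<prefixTrues (true ∷ x) (suc u) (suc k) (s≤s k<x) kth≤u =
  s≤s (kth≤⇒<prefixTrues x u k k<x′ (≤-pred (subst (_≤ suc u) (kth-map-suc (members x) k k<x′) kth≤u)))
  where k<x′ = subst (k <_) (length-map suc (members x)) k<x
kth≤⇒<prefixTrues (false ∷ x) (suc u) k k<x kth≤u =
  kth≤⇒<prefixTrues x u k k<x′ (≤-pred (subst (_≤ suc u) (kth-map-suc (members x) k k<x′) kth≤u))
  where k<x′ = subst (k <_) (length-map suc (members x)) k<x

prefixTrues≤trues : ∀ u x → prefixTrues x u ≤ trues x
prefixTrues≤trues zero x = z≤n
prefixTrues≤trues (suc u) [] = z≤n
prefixTrues≤trues (suc u) (true ∷ x) = s≤s (prefixTrues≤trues u x)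
prefixTrues≤trues (suc u) (false ∷ x) = prefixTrues≤trues u x

⊑⇒⊴ : ∀ {m} (I J : Subset m) → I ⊑ J → toList J ⊴ toList I
⊑⇒⊴ I J (inj₁ J≡[]) u =
  ≤-trans (prefixTrues≤trues u (toList J))
          (≤-trans (≤-reflexive (trans (sym (length-members (toList J))) (cong length (trans (sym (elems≡members J)) J≡[])))) z≤n)
⊑⇒⊴ I J (inj₂ (_ , #J≤#I , I≤J)) u = bound (prefixTrues (toList J) u) ≤-refl
  where
  bound : ∀ c → c ≤ prefixTrues (toList J) u → c ≤ prefixTrues (toList I) u
  bound zero _ = z≤n
  bound (suc k) k<J with <prefixTrues⇒kth≤ (toList J) u k k<J
  ... | k<#J , kth≤u =
    kth≤⇒<prefixTrues (toList I) u k (subst (λ l → k < length l) (elems≡members I) k<#I)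
      (≤-trans (subst₂ _≤_ (cong (λ l → kth l k) (elems≡members I)) (cong (λ l → kth l k) (elems≡members J)) (I≤J k k<#J′)) kth≤u)
    where
    k<#J′ : k < length (elems J)
    k<#J′ = subst (λ l → k < length l) (sym (elems≡members J)) k<#J
    k<#I : k < length (elems I)
    k<#I = <-≤-trans k<#J′ #J≤#I

⊴⇒⊑ : ∀ {m} (I J : Subset m) → toList J ⊴ toList I → I ⊑ J
⊴⇒⊑ {m} I J J⊴I with elems J in J≡
... | [] = inj₁ refl
... | j ∷ js = inj₂ (I≢[] , #J≤#I , I≤J)
  where
  #members : ∀ (K : Subset m) → length (elems K) ≡ prefixTrues (toList K) m
  #members K = trans (cong length (elems≡members K))
                     (trans (length-members (toList K)) (cong trues (sym (take-all m (toList K) (≤-reflexive (length-toList K))))))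
  #J≤#I : length (j ∷ js) ≤ length (elems I)
  #J≤#I = subst₂ _≤_ (trans (sym (#members J)) (cong length J≡)) (sym (#members I)) (J⊴I m)
  I≢[] : elems I ≡ [] → ⊥
  I≢[] I≡[] with subst (length (j ∷ js) ≤_) (cong length I≡[]) #J≤#I
  ... | ()
  I≤J : ∀ k → k < length (j ∷ js) → kth (elems I) k ≤ kth (j ∷ js) k
  I≤J k k<J = subst₂ _≤_ (cong (λ l → kth l k) (sym (elems≡members I))) (cong (λ l → kth l k) (trans (sym (elems≡members J)) J≡))
    (proj₂ (<prefixTrues⇒kth≤ (toList I) u k (≤-trans (kth≤⇒<prefixTrues (toList J) u k k<members ≤-refl) (J⊴I u))))
    where
    k<members : k < length (members (toList J))
    k<members = subst (λ l → k < length l) (trans (sym J≡) (elems≡members J)) k<J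
    u = kth (members (toList J)) k

-- Dominated suffix counts give subwords

countFrom : ℕ → List ℕ → ℕ
countFrom t es = length (filter (t ≤?_) es)

countFrom-accept : ∀ {t e} es → t ≤ e → countFrom t (e ∷ es) ≡ suc (countFrom t es)
countFrom-accept {t} es t≤e = cong length (filter-accept (t ≤?_) t≤e)

countFrom-reject : ∀ {t e} es → e < t → countFrom t (e ∷ es) ≡ countFrom t es
countFrom-reject {t} es e<t = cong length (filter-reject (t ≤?_) (<⇒≱ e<t))

countFrom-all : ∀ t es → All (t ≤_) es → countFrom t es ≡ length es
countFrom-all t es t≤es = cong length (filter-all (t ≤?_) t≤es)

countFrom≤length : ∀ t es → countFrom t es ≤ length es
countFrom≤length t es = length-filter (t ≤?_) es

countFrom-map-suc : ∀ t es → countFrom (suc t) (map suc es) ≡ countFrom t es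
countFrom-map-suc t [] = refl
countFrom-map-suc t (e ∷ es) with t ≤? e
... | yes t≤e = trans (countFrom-accept (map suc es) (s≤s t≤e))
                      (trans (cong suc (countFrom-map-suc t es)) (sym (countFrom-accept es t≤e)))
... | no t≰e = trans (countFrom-reject (map suc es) (s≤s (≰⇒> t≰e)))
                     (trans (countFrom-map-suc t es) (sym (countFrom-reject es (≰⇒> t≰e))))

trues≡length-positions : ∀ {m} (G : Subset m) → trues (toList G) ≡ length (positions G)
trues≡length-positions G = begin
  trues (toList G)                  ≡⟨ length-members (toList G) ⟨
  length (members (toList G))       ≡⟨ cong length (elems≡members G) ⟨
  length (elems G)                  ≡⟨ length-map _ (elemsF G) ⟩
  length (elemsF G)                 ≡⟨ length-map toℕ (elemsF G) ⟨
  length (positions G)              ∎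
  where open ≡-Reasoning

suffixTrues-toList : ∀ {m} (G : Subset m) t → suffixTrues (toList G) t ≡ countFrom t (positions G)
suffixTrues-toList G zero =
  trans (trues≡length-positions G) (sym (countFrom-all 0 (positions G) (All.universal (λ _ → z≤n) (positions G))))
suffixTrues-toList [] (suc t) = refl
suffixTrues-toList (true ∷ G) (suc t) rewrite map-toℕ-suc (elemsF G) =
  trans (suffixTrues-toList G t)
        (sym (trans (countFrom-reject (map suc (positions G)) (s≤s z≤n)) (countFrom-map-suc t (positions G))))
suffixTrues-toList (false ∷ G) (suc t) rewrite map-toℕ-suc (elemsF G) =
  trans (suffixTrues-toList G t) (sym (countFrom-map-suc t (positions G)))

down⊆down : ∀ {n} j k (p : j ≤ n) (q : k ≤ n) → j ≤ k → down j p ⊆ down k q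
down⊆down zero zero p q _ = []
down⊆down j (suc k) p q j≤1+k with m≤n⇒m<n∨m≡n j≤1+k
... | inj₁ (s≤s j≤k) = fromℕ< q ∷ʳ down⊆down j k p (<⇒≤ q) j≤k
... | inj₂ refl = ⊆-reflexive (cong (down j) (≤-irrelevant p q))

wk⊆wk : ∀ {n} (x y : Fin n) → toℕ x ≤ toℕ y → wk x ⊆ wk y
wk⊆wk x y x≤y = down⊆down _ _ _ _ (s≤s x≤y)

dominated-by-tail : ∀ {y} xs ys → All (y <_) ys → length xs ≤ length ys →
  (∀ t → y < t → countFrom t xs ≤ countFrom t (y ∷ ys)) → ∀ t → countFrom t xs ≤ countFrom t ys
dominated-by-tail {y} xs ys y<ys #xs≤#ys dom t with t ≤? y
... | yes t≤y = ≤-trans (countFrom≤length t xs)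
                        (≤-trans #xs≤#ys (≤-reflexive (sym (countFrom-all t ys (All.map (λ y<z → ≤-trans t≤y (<⇒≤ y<z)) y<ys)))))
... | no t≰y = subst (countFrom t xs ≤_) (countFrom-reject ys (≰⇒> t≰y)) (dom t (≰⇒> t≰y))

-- Greedy matching: the head y of ys is skipped while xs fits into the tail of ys; otherwise it is
-- matched with the head x of xs, and dominance at t = x forces x ≤ y.
dominated⇒subword : ∀ {n} (ys xs : List (Fin n)) → AllPairs _<_ (map toℕ xs) → AllPairs _<_ (map toℕ ys) →
  (∀ t → countFrom t (map toℕ xs) ≤ countFrom t (map toℕ ys)) → concatMap wk xs ⊆ concatMap wk ys
dominated⇒subword [] [] _ _ _ = []
dominated⇒subword [] (x ∷ xs) _ _ dom with dom 0
... | ()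
dominated⇒subword (y ∷ ys) xs xs↑ (y<ys ∷ ys↑) dom with length xs ≤? length ys
... | yes #xs≤#ys =
  ++⁺ˡ (wk y) (dominated⇒subword ys xs xs↑ ys↑
    (dominated-by-tail (map toℕ xs) (map toℕ ys) y<ys (subst₂ _≤_ (sym (length-map toℕ xs)) (sym (length-map toℕ ys)) #xs≤#ys)
      (λ t _ → dom t)))
dominated⇒subword (y ∷ ys) [] _ _ _ | no #xs≰#ys = ⊥-elim (#xs≰#ys z≤n)
dominated⇒subword (y ∷ ys) (x ∷ xs) (x<xs ∷ xs↑) (y<ys ∷ ys↑) dom | no #xs≰#ys =
  ++⁺ (wk⊆wk x y x≤y) (dominated⇒subword ys xs xs↑ ys↑ (dominated-by-tail (map toℕ xs) (map toℕ ys) y<ys #xs≤#ys dom′))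
  where
  #xs≤#ys : length (map toℕ xs) ≤ length (map toℕ ys)
  #xs≤#ys = ≤-pred (subst₂ _≤_ (countFrom-all 0 (map toℕ (x ∷ xs)) (All.universal (λ _ → z≤n) _))
                                 (countFrom-all 0 (map toℕ (y ∷ ys)) (All.universal (λ _ → z≤n) _)) (dom 0))
  #ys≤#xs : length (map toℕ ys) ≤ length (map toℕ xs)
  #ys≤#xs = subst₂ _≤_ (sym (length-map toℕ ys)) (sym (length-map toℕ xs)) (≤-pred (≰⇒> #xs≰#ys))
  x≤y : toℕ x ≤ toℕ y
  x≤y with toℕ x ≤? toℕ y
  ... | yes x≤y = x≤y
  ... | no x≰y = ⊥-elim (<-irrefl refl (begin-strict
    length (map toℕ xs)                      ≡⟨ countFrom-all (toℕ x) _ (All.map <⇒≤ x<xs) ⟨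
    countFrom (toℕ x) (map toℕ xs)           <⟨ ≤-reflexive (sym (countFrom-accept (map toℕ xs) ≤-refl)) ⟩
    countFrom (toℕ x) (map toℕ (x ∷ xs))     ≤⟨ dom (toℕ x) ⟩
    countFrom (toℕ x) (map toℕ (y ∷ ys))     ≡⟨ countFrom-reject (map toℕ ys) (≰⇒> x≰y) ⟩
    countFrom (toℕ x) (map toℕ ys)           ≤⟨ countFrom≤length (toℕ x) (map toℕ ys) ⟩
    length (map toℕ ys)                      ≤⟨ #ys≤#xs ⟩
    length (map toℕ xs)                      ∎))
    where open ≤-Reasoning
  dom′ : ∀ t → toℕ y < t → countFrom t (map toℕ xs) ≤ countFrom t (map toℕ (y ∷ ys))
  dom′ t y<t = subst (_≤ countFrom t (map toℕ (y ∷ ys))) (countFrom-reject (map toℕ xs) (≤-<-trans x≤y y<t)) (dom t)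

≼⇒wSet⊆ : ∀ {n} (G H : Subset n) → toList G ≼ toList H → wSet G ⊆ wSet H
≼⇒wSet⊆ G H G≼H = dominated⇒subword (elemsF H) (elemsF G) (positions-increasing G) (positions-increasing H)
  (λ t → subst₂ _≤_ (suffixTrues-toList G t) (suffixTrues-toList H t) (G≼H t))

-- Tight words; α is an order embedding

Tight⇒Reduced : ∀ {n} {a : Word n} → Tight a → Reduced a
Tight⇒Reduced {a = a} tight b b≈a =
  ≤-trans (≤-reflexive (trans (sym tight) (cong (weight 1) (sym (≈⇒signs≡ b≈a))))) (weight-signs≤length b)

≈Tight⇒Tight : ∀ {n} {a b : Word n} → a ≈ b → Tight b → Reduced a → Tight a
≈Tight⇒Tight {a = a} {b} a≈b tight-b reduced-a =
  ≤-antisym (weight-signs≤length a)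
            (≤-trans (reduced-a b (≈sym a≈b)) (≤-reflexive (trans (sym tight-b) (cong (weight 1) (sym (≈⇒signs≡ a≈b))))))

HasLength⇒weight≤ : ∀ {n} {w : Word n} {k} → HasLength w k → weight 1 (signs w) ≤ k
HasLength⇒weight≤ ((a , a≈w , a≡k) , _) =
  ≤-trans (≤-reflexive (cong (weight 1) (sym (≈⇒signs≡ a≈w)))) (subst (_ ≤_) a≡k (weight-signs≤length a))

HasLength⇒even≡ : ∀ {n} {w : Word n} {k} → HasLength w k → even k ≡ even (length w)
HasLength⇒even≡ ((a , a≈w , refl) , _) = ≈⇒even-length≡ a≈w

swap-replicate-false : ∀ k m → Sign.swap k (replicate m false) ≡ replicate m false
swap-replicate-false zero zero = refl
swap-replicate-false zero (suc zero) = refl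
swap-replicate-false zero (suc (suc m)) = refl
swap-replicate-false (suc k) zero = refl
swap-replicate-false (suc k) (suc m) = cong (false ∷_) (swap-replicate-false k m)

signs-∷ʳ : ∀ {n} (w : Word n) (i : Fin n) → 1 ≤ toℕ i → signs (w ++ [ i ]) ≡ signs w
signs-∷ʳ {n} w i 1≤i = trans (Sign.act-++ w [ i ] (replicate n false)) (cong (Sign.act w) (fixed (toℕ i) 1≤i))
  where
  fixed : ∀ c → 1 ≤ c → Sign.gen c (replicate n false) ≡ replicate n false
  fixed (suc k) _ = swap-replicate-false k n

-- The s_i with i ≥ 1 fix the all-false pattern, so ℓ(w s_i) ≥ weight = ℓ(w); parity excludes equality.
Tight⇒InQuot : ∀ {n} {w : Word n} → Tight w → InQuot w
Tight⇒InQuot {w = w} tight i 1≤i k m ℓ-w≡k ℓ-wi≡m = ≤∧≢⇒< k≤m k≢m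
  where
  k≡w : k ≡ length w
  k≡w = ≤-antisym (proj₂ ℓ-w≡k w ≈refl) (subst (_≤ k) tight (HasLength⇒weight≤ ℓ-w≡k))
  k≤m : k ≤ m
  k≤m = subst (_≤ m) (trans tight (sym k≡w)) (subst (λ x → weight 1 x ≤ m) (signs-∷ʳ w i 1≤i) (HasLength⇒weight≤ ℓ-wi≡m))
  k≢m : k ≢ m
  k≢m k≡m = not-¬ refl (begin
    even (length w)               ≡⟨ HasLength⇒even≡ ℓ-w≡k ⟨
    even k                        ≡⟨ cong even k≡m ⟩
    even m                        ≡⟨ HasLength⇒even≡ ℓ-wi≡m ⟩
    even (length (w ++ [ i ]))    ≡⟨ cong even (trans (length-++ w) (+-comm (length w) 1)) ⟩
    even (suc (length w))         ≡⟨ even-suc (length w) ⟩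
    not (even (length w))         ∎)
    where open ≡-Reasoning

Tight-α : ∀ {n} (I : Subset n) → Tight (α I)
Tight-α I = Tight-wSet (g I)

signs-α : ∀ {n} (I : Subset n) → signs (α I) ≡ reverse (map not (toList I))
signs-α I = trans (signs-wSet (g I)) (toList-g I)

α-injective : ∀ {n} (I J : Subset n) → α I ≈ α J → I ≡ J
α-injective I J αI≈αJ = begin
  I         ≡⟨ g-involutive I ⟨
  g (g I)   ≡⟨ cong g (toList-injective′ gI≡gJ) ⟩
  g (g J)   ≡⟨ g-involutive J ⟩
  J         ∎
  where
  open ≡-Reasoning
  gI≡gJ : toList (g I) ≡ toList (g J)
  gI≡gJ = trans (sym (signs-wSet (g I))) (trans (≈⇒signs≡ αI≈αJ) (signs-wSet (g J)))

⊑⇒α≤B : ∀ {n} (I J : Subset n) → I ⊑ J → α I ≤B α J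
⊑⇒α≤B {n} I J I⊑J = α J , ≈refl , Tight⇒Reduced (Tight-α J) , α I , αI⊆αJ , Tight⇒Reduced (Tight-α I) , ≈refl
  where
  gI≼gJ : toList (g I) ≼ toList (g J)
  gI≼gJ = subst₂ _≼_ (sym (toList-g I)) (sym (toList-g J))
            (⊴⇒≼-reverse-not n (toList I) (toList J) (length-toList I) (length-toList J) (⊑⇒⊴ I J I⊑J))
  αI⊆αJ : α I ⊆ α J
  αI⊆αJ = ≼⇒wSet⊆ (g I) (g J) gI≼gJ

α≤B⇒⊑ : ∀ {n} (I J : Subset n) → α I ≤B α J → I ⊑ J
α≤B⇒⊑ {n} I J (a , a≈αJ , reduced-a , b , b⊆a , reduced-b , b≈αI) =
  ⊴⇒⊑ I J (≼-reverse-not⇒⊴ n (toList I) (toList J) (length-toList I) (length-toList J)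
    (subst₂ _≼_ (trans (≈⇒signs≡ b≈αI) (signs-α I)) (trans (≈⇒signs≡ a≈αJ) (signs-α J))
      (subword⇒signs≼ b⊆a (≈Tight⇒Tight a≈αJ (Tight-α J) reduced-a) (≈Tight⇒Tight b≈αI (Tight-α I) reduced-b))))

-- Normal forms

All-desc : ∀ (P : ℕ → Set) lo c → (∀ x → lo ≤ x → x < lo + c → P x) → All P (desc lo c)
All-desc P lo zero f = []
All-desc P lo (suc c) f = f (lo + c) (m≤m+n lo c) (+-monoʳ-< lo (n<1+n c)) ∷
  All-desc P lo c (λ x lo≤x x<lo+c → f x lo≤x (<-trans x<lo+c (+-monoʳ-< lo (n<1+n c))))

All-asc : ∀ (P : ℕ → Set) lo c → (∀ x → lo ≤ x → x < lo + c → P x) → All P (asc lo c)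
All-asc P lo zero f = []
All-asc P lo (suc c) f = f lo ≤-refl (subst (lo <_) (sym (+-suc lo c)) (s≤s (m≤m+n lo c))) ∷
  All-asc P (suc lo) c (λ x lo<x x<lo+c → f x (≤-trans (n≤1+n lo) lo<x) (subst (x <_) (sym (+-suc lo c)) x<lo+c))

desc-∷ʳ : ∀ l c → desc (suc l) c ++ [ l ] ≡ desc l (suc c)
desc-∷ʳ l zero = cong [_] (sym (+-identityʳ l))
desc-∷ʳ l (suc c) = cong₂ _∷_ (sym (+-suc l c)) (desc-∷ʳ l c)

desc-+ : ∀ lo a b → desc lo (a + b) ≡ desc (lo + b) a ++ desc lo b
desc-+ lo zero b = refl
desc-+ lo (suc a) b = cong₂ _∷_ (trans (cong (lo +_) (+-comm a b)) (sym (+-assoc lo b a))) (desc-+ lo a b)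

asc-∷ʳ : ∀ lo c → asc lo c ++ [ lo + c ] ≡ asc lo (suc c)
asc-∷ʳ lo zero = cong [_] (+-identityʳ lo)
asc-∷ʳ lo (suc c) = cong (lo ∷_) (trans (cong (λ z → asc (suc lo) c ++ [ z ]) (+-suc lo c)) (asc-∷ʳ (suc lo) c))

asc-+ : ∀ lo a b → asc lo (a + b) ≡ asc lo a ++ asc (lo + a) b
asc-+ lo zero b = cong (λ z → asc z b) (sym (+-identityʳ lo))
asc-+ lo (suc a) b = cong (lo ∷_) (trans (asc-+ (suc lo) a b) (cong (λ z → asc (suc lo) a ++ asc z b) (sym (+-suc lo a))))

length-asc : ∀ lo c → length (asc lo c) ≡ c
length-asc lo zero = refl
length-asc lo (suc c) = cong suc (length-asc (suc lo) c)

-- The minimal representatives of the cosets of B_(k-1) in B_k, one of each length r < 2k: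
-- s_(k-1) ⋯ s_(k-r) for r ≤ k, and s_(k-1) ⋯ s_1 s_0 s_1 ⋯ s_(r-k) for r ≥ k.
coset : ℕ → ℕ → List ℕ
coset k r = desc (k ∸ r) (r ⊓ k) ++ asc 1 (r ∸ k)

coset-short : ∀ m r → coset (m + r) r ≡ desc m r
coset-short m r rewrite m+n∸n≡m m r | m≤n⇒m⊓n≡m (m≤n+m r m) | m≤n⇒m∸n≡0 (m≤n+m r m) = ++-identityʳ (desc m r)

coset-long : ∀ k j → coset k (k + j) ≡ desc 0 k ++ asc 1 j
coset-long k j rewrite m≤n⇒m∸n≡0 (m≤m+n k j) | m≥n⇒m⊓n≡n (m≤m+n k j) | m+n∸m≡n k j = refl

data CosetView (k r : ℕ) : Set where
  short : ∀ m → k ≡ m + r → CosetView k r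
  long  : ∀ j → r ≡ k + suc j → CosetView k r

cosetView : ∀ k r → CosetView k r
cosetView k zero = short k (sym (+-identityʳ k))
cosetView zero (suc r) = long r refl
cosetView (suc k) (suc r) with cosetView k r
... | short m k≡m+r = short m (trans (cong suc k≡m+r) (sym (+-suc m r)))
... | long j r≡k+1+j = long j (cong suc r≡k+1+j)

length-coset : ∀ k r → length (coset k r) ≡ r
length-coset k r with cosetView k r
... | short m refl = trans (cong length (coset-short m r)) (length-desc m r)
... | long j refl = trans (cong length (coset-long k (suc j)))
                          (trans (length-++ (desc 0 k)) (cong₂ _+_ (length-desc 0 k) (length-asc 1 (suc j))))

coset-letters : ∀ k r → r < k + k → All (_< k) (coset k r)
coset-letters k r r<2k with cosetView k r
... | short m refl = subst (All (_< m + r)) (sym (coset-short m r)) (All-desc _ m r (λ _ _ x<m+r → x<m+r))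
... | long j refl = subst (All (_< k)) (sym (coset-long k (suc j)))
  (All.++⁺ (All-desc _ 0 k (λ _ _ x<k → x<k))
           (All-asc _ 1 (suc j) (λ _ _ x<2+j → <-≤-trans x<2+j (+-cancelˡ-≤ k _ _ (≤-trans (≤-reflexive (+-suc k (suc j))) r<2k)))))

-- A code r_n ∷ ⋯ ∷ r_1 with r_k < 2k; its normal form is the product of the coset representatives.
Code : List ℕ → Set
Code [] = ⊤
Code (r ∷ rest) = r < suc (length rest) + suc (length rest) × Code rest

nf : List ℕ → List ℕ
nf [] = []
nf (r ∷ rest) = nf rest ++ coset (suc (length rest)) r

nf-letters : ∀ d → Code d → All (_< length d) (nf d)
nf-letters [] _ = []
nf-letters (r ∷ rest) (r<2k , code) =
  All.++⁺ (All.map (λ x<k → <-trans x<k (n<1+n _)) (nf-letters rest code)) (coset-letters _ r r<2k)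

length-nf : ∀ r rest → length (nf (r ∷ rest)) ≡ length (nf rest) + r
length-nf r rest = trans (length-++ (nf rest)) (cong (length (nf rest) +_) (length-coset _ r))

-- Every representative other than 1 and s_(k-1) ⋯ s_0 ends in a letter s_e with e ≥ 1.
EndsInDescent : ℕ → ℕ → Set
EndsInDescent k r = ∃ λ e → 1 ≤ e × e < k × ∃ λ r′ → r ≡ suc r′ × coset k r ≡ coset k r′ ++ [ e ]

coset-ends-in-descent : ∀ k r → r < k + k → r ≢ 0 → r ≢ k → EndsInDescent k r
coset-ends-in-descent k r r<2k r≢0 r≢k with cosetView k r
... | short m refl = short-case m r r≢0 r≢k
  where
  short-case : ∀ m r → r ≢ 0 → r ≢ m + r → EndsInDescent (m + r) r
  short-case m zero r≢0 _ = ⊥-elim (r≢0 refl)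
  short-case zero (suc r) _ r≢r = ⊥-elim (r≢r refl)
  short-case (suc m) (suc r) _ _ =
    suc m , s≤s z≤n , ≤-trans (s≤s (m≤m+n (suc m) r)) (≤-reflexive (sym (+-suc (suc m) r))) , r , refl ,
    trans (coset-short (suc m) (suc r)) (trans (sym (desc-∷ʳ (suc m) r))
      (cong (_++ [ suc m ]) (sym (trans (cong (λ z → coset z r) (+-suc (suc m) r)) (coset-short (suc (suc m)) r)))))
... | long j refl =
  suc j , s≤s z≤n , +-cancelˡ-< k (suc j) k r<2k , k + j , +-suc k j ,
  trans (coset-long k (suc j)) (trans (cong (desc 0 k ++_) (sym (asc-∷ʳ 1 j)))
    (trans (sym (++-assoc (desc 0 k) (asc 1 j) [ suc j ])) (cong (_++ [ suc j ]) (sym (coset-long k j)))))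

-- The codes of the words w_G: every r_k is 0 or k.
ZeroOrFull : List ℕ → Set
ZeroOrFull [] = ⊤
ZeroOrFull (r ∷ rest) = (r ≡ 0 ⊎ r ≡ suc (length rest)) × ZeroOrFull rest

fullFlags : List ℕ → List Bool
fullFlags [] = []
fullFlags (r ∷ rest) = fullFlags rest ++ [ r ≡ᵇ suc (length rest) ]

length-fullFlags : ∀ d → length (fullFlags d) ≡ length d
length-fullFlags [] = refl
length-fullFlags (r ∷ rest) = trans (length-++ (fullFlags rest)) (trans (+-comm _ 1) (cong suc (length-fullFlags rest)))

truePositions : List Bool → List ℕ
truePositions [] = []
truePositions (true ∷ xs) = 0 ∷ map suc (truePositions xs)
truePositions (false ∷ xs) = map suc (truePositions xs)

truePositions-∷ʳ : ∀ xs b → truePositions (xs ++ [ b ]) ≡ truePositions xs ++ (if b then [ length xs ] else [])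
truePositions-∷ʳ [] true = refl
truePositions-∷ʳ [] false = refl
truePositions-∷ʳ (true ∷ xs) b = cong (0 ∷_) (map-suc-∷ʳ xs b)
  where
  map-suc-∷ʳ : ∀ xs b → map suc (truePositions (xs ++ [ b ])) ≡ map suc (truePositions xs) ++ (if b then [ suc (length xs) ] else [])
  map-suc-∷ʳ xs true = trans (cong (map suc) (truePositions-∷ʳ xs true)) (map-++ suc (truePositions xs) _)
  map-suc-∷ʳ xs false = trans (cong (map suc) (truePositions-∷ʳ xs false)) (map-++ suc (truePositions xs) _)
truePositions-∷ʳ (false ∷ xs) true = trans (cong (map suc) (truePositions-∷ʳ xs true)) (map-++ suc (truePositions xs) _)
truePositions-∷ʳ (false ∷ xs) false = trans (cong (map suc) (truePositions-∷ʳ xs false)) (map-++ suc (truePositions xs) _)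

positions≡truePositions : ∀ {m} (G : Subset m) → positions G ≡ truePositions (toList G)
positions≡truePositions [] = refl
positions≡truePositions (true ∷ G) = cong (0 ∷_) (trans (map-toℕ-suc (elemsF G)) (cong (map suc) (positions≡truePositions G)))
positions≡truePositions (false ∷ G) = trans (map-toℕ-suc (elemsF G)) (cong (map suc) (positions≡truePositions G))

wℕ-++ : ∀ xs ys → wℕ (xs ++ ys) ≡ wℕ xs ++ wℕ ys
wℕ-++ [] ys = refl
wℕ-++ (x ∷ xs) ys = trans (cong (desc 0 (suc x) ++_) (wℕ-++ xs ys)) (sym (++-assoc (desc 0 (suc x)) (wℕ xs) (wℕ ys)))

≡ᵇ-refl : ∀ k → (k ≡ᵇ k) ≡ true
≡ᵇ-refl zero = refl
≡ᵇ-refl (suc k) = ≡ᵇ-refl k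

nf-ZeroOrFull : ∀ d → ZeroOrFull d → nf d ≡ wℕ (truePositions (fullFlags d))
nf-ZeroOrFull [] _ = refl
nf-ZeroOrFull (r ∷ rest) (inj₁ refl , zf) = begin
  nf rest ++ []                                              ≡⟨ ++-identityʳ (nf rest) ⟩
  nf rest                                                    ≡⟨ nf-ZeroOrFull rest zf ⟩
  wℕ (truePositions (fullFlags rest))                        ≡⟨ ++-identityʳ _ ⟨
  wℕ (truePositions (fullFlags rest)) ++ wℕ []               ≡⟨ wℕ-++ (truePositions (fullFlags rest)) [] ⟨
  wℕ (truePositions (fullFlags rest) ++ [])                  ≡⟨ cong wℕ (truePositions-∷ʳ (fullFlags rest) false) ⟨
  wℕ (truePositions (fullFlags rest ++ [ false ]))           ∎
  where open ≡-Reasoning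
nf-ZeroOrFull (r ∷ rest) (inj₂ refl , zf) = begin
  nf rest ++ coset k k                                         ≡⟨ cong₂ _++_ (nf-ZeroOrFull rest zf) (coset-short 0 k) ⟩
  wℕ (truePositions (fullFlags rest)) ++ desc 0 k              ≡⟨ cong (λ l → wℕ (truePositions (fullFlags rest)) ++ desc 0 (suc l)) (length-fullFlags rest) ⟨
  wℕ (truePositions (fullFlags rest)) ++ desc 0 (suc (length (fullFlags rest)))
                                                               ≡⟨ cong (wℕ (truePositions (fullFlags rest)) ++_) (++-identityʳ _) ⟨
  wℕ (truePositions (fullFlags rest)) ++ wℕ [ length (fullFlags rest) ]
                                                               ≡⟨ wℕ-++ (truePositions (fullFlags rest)) _ ⟨
  wℕ (truePositions (fullFlags rest) ++ [ length (fullFlags rest) ])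
                                                               ≡⟨ cong wℕ (truePositions-∷ʳ (fullFlags rest) true) ⟨
  wℕ (truePositions (fullFlags rest ++ [ true ]))              ≡⟨ cong (λ b → wℕ (truePositions (fullFlags rest ++ [ b ]))) (≡ᵇ-refl k) ⟨
  wℕ (truePositions (fullFlags rest ++ [ k ≡ᵇ k ]))            ∎
  where
  open ≡-Reasoning
  k = suc (length rest)

subsetOf : ∀ {n} (xs : List Bool) → length xs ≡ n → Subset n
subsetOf xs refl = fromList xs

toList-subsetOf : ∀ {n} xs (xs≡n : length xs ≡ n) → toList (subsetOf xs xs≡n) ≡ xs
toList-subsetOf xs refl = toList∘fromList xs

Labelled : Set
Labelled = Bool × ℕ

flipSign : Labelled → Labelled
flipSign (b , v) = (not b , v)

flipSign-involutive : ∀ x → flipSign (flipSign x) ≡ x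
flipSign-involutive (b , v) = cong (_, v) (not-involutive b)

module Label = SignedAction flipSign

entryAt : ∀ {A : Set} → List A → ℕ → Maybe A
entryAt [] _ = nothing
entryAt (x ∷ xs) zero = just x
entryAt (x ∷ xs) (suc p) = entryAt xs p

swapIndex : ℕ → ℕ → ℕ
swapIndex zero zero = 1
swapIndex zero (suc zero) = 0
swapIndex zero (suc (suc p)) = suc (suc p)
swapIndex (suc q) zero = zero
swapIndex (suc q) (suc p) = suc (swapIndex q p)

swapIndex-involutive : ∀ q p → swapIndex q (swapIndex q p) ≡ p
swapIndex-involutive zero zero = refl
swapIndex-involutive zero (suc zero) = refl
swapIndex-involutive zero (suc (suc p)) = refl
swapIndex-involutive (suc q) zero = refl
swapIndex-involutive (suc q) (suc p) = cong suc (swapIndex-involutive q p)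

swapIndex-suc : ∀ q → swapIndex q (suc q) ≡ q
swapIndex-suc zero = refl
swapIndex-suc (suc q) = cong suc (swapIndex-suc q)

swapIndex-self : ∀ q → swapIndex q q ≡ suc q
swapIndex-self zero = refl
swapIndex-self (suc q) = cong suc (swapIndex-self q)

entryAt-swap : ∀ q y → suc q < length y → ∀ p → entryAt (Label.swap q y) p ≡ entryAt y (swapIndex q p)
entryAt-swap zero (a ∷ b ∷ ys) _ zero = refl
entryAt-swap zero (a ∷ b ∷ ys) _ (suc zero) = refl
entryAt-swap zero (a ∷ b ∷ ys) _ (suc (suc p)) = refl
entryAt-swap (suc q) (a ∷ ys) _ zero = refl
entryAt-swap (suc q) (a ∷ ys) (s≤s 1+q<y) (suc p) = entryAt-swap q ys 1+q<y p
entryAt-swap zero (a ∷ []) (s≤s ()) p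

entryAt-negateHead-zero : ∀ y → entryAt (Label.negateHead y) 0 ≡ Maybe.map flipSign (entryAt y 0)
entryAt-negateHead-zero [] = refl
entryAt-negateHead-zero (x ∷ y) = refl

entryAt-negateHead-suc : ∀ y p → entryAt (Label.negateHead y) (suc p) ≡ entryAt y (suc p)
entryAt-negateHead-suc [] p = refl
entryAt-negateHead-suc (x ∷ y) p = refl

entryAt-defined : ∀ {A : Set} (y : List A) p → p < length y → ∃ λ x → entryAt y p ≡ just x
entryAt-defined (x ∷ y) zero _ = x , refl
entryAt-defined (x ∷ y) (suc p) (s≤s p<y) = entryAt-defined y p p<y

entryAt-swap-below : ∀ c y p → suc c < p → entryAt (Label.swap c y) p ≡ entryAt y p
entryAt-swap-below zero [] p _ = refl
entryAt-swap-below zero (a ∷ []) p _ = refl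
entryAt-swap-below zero (a ∷ b ∷ ys) (suc (suc p)) _ = refl
entryAt-swap-below zero (a ∷ b ∷ ys) (suc zero) (s≤s ())
entryAt-swap-below (suc c) [] p _ = refl
entryAt-swap-below (suc c) (a ∷ ys) (suc p) (s≤s 1+c<p) = entryAt-swap-below c ys p 1+c<p

entryAt-gen-below : ∀ c y p → c < p → entryAt (Label.gen c y) p ≡ entryAt y p
entryAt-gen-below zero y (suc p) _ = entryAt-negateHead-suc y p
entryAt-gen-below (suc c) y p 1+c<p = entryAt-swap-below c y p 1+c<p

entryAt-actℕ-below : ∀ w y p → All (_< p) w → entryAt (Label.actℕ w y) p ≡ entryAt y p
entryAt-actℕ-below [] y p _ = refl
entryAt-actℕ-below (c ∷ w) y p (c<p ∷ w<p) = trans (entryAt-gen-below c (Label.actℕ w y) p c<p) (entryAt-actℕ-below w y p w<p)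

entryAt-desc : ∀ l c y → l + c < length y → entryAt (Label.actℕ (desc (suc l) c) y) (l + c) ≡ entryAt y l
entryAt-desc l zero y l+c<y = cong (entryAt y) (+-identityʳ l)
entryAt-desc l (suc c) y l+c<y = begin
  entryAt (Label.swap (l + c) (Label.actℕ (desc (suc l) c) y)) (l + suc c) ≡⟨ cong (entryAt (Label.swap (l + c) (Label.actℕ (desc (suc l) c) y))) (+-suc l c) ⟩
  entryAt (Label.swap (l + c) (Label.actℕ (desc (suc l) c) y)) (suc (l + c)) ≡⟨ entryAt-swap (l + c) _ (subst (suc (l + c) <_) (sym (Label.length-actℕ (desc (suc l) c) y)) (subst (_< length y) (+-suc l c) l+c<y)) (suc (l + c)) ⟩
  entryAt (Label.actℕ (desc (suc l) c) y) (swapIndex (l + c) (suc (l + c))) ≡⟨ cong (entryAt (Label.actℕ (desc (suc l) c) y)) (swapIndex-suc (l + c)) ⟩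
  entryAt (Label.actℕ (desc (suc l) c) y) (l + c) ≡⟨ entryAt-desc l c y (<-trans (+-monoʳ-< l (n<1+n c)) l+c<y) ⟩
  entryAt y l ∎
  where open ≡-Reasoning

entryAt-asc : ∀ l c y → l + c < length y → entryAt (Label.actℕ (asc (suc l) c) y) l ≡ entryAt y (l + c)
entryAt-asc l zero y l+c<y = cong (entryAt y) (sym (+-identityʳ l))
entryAt-asc l (suc c) y l+c<y = begin
  entryAt (Label.swap l (Label.actℕ (asc (suc (suc l)) c) y)) l ≡⟨ entryAt-swap l _ (subst (suc l <_) (sym (Label.length-actℕ (asc (suc (suc l)) c) y)) (≤-trans (s≤s (s≤s (m≤m+n l c))) (subst (_< length y) (+-suc l c) l+c<y))) l ⟩
  entryAt (Label.actℕ (asc (suc (suc l)) c) y) (swapIndex l l) ≡⟨ cong (entryAt (Label.actℕ (asc (suc (suc l)) c) y)) (swapIndex-self l) ⟩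
  entryAt (Label.actℕ (asc (suc (suc l)) c) y) (suc l) ≡⟨ entryAt-asc (suc l) c y (subst (_< length y) (+-suc l c) l+c<y) ⟩
  entryAt y (suc l + c) ≡⟨ cong (entryAt y) (sym (+-suc l c)) ⟩
  entryAt y (l + suc c) ∎
  where open ≡-Reasoning

entryAt-desc-0 : ∀ c y → c < length y → entryAt (Label.actℕ (desc 0 (suc c)) y) c ≡ Maybe.map flipSign (entryAt y 0)
entryAt-desc-0 c y c<y = trans (cong (λ z → entryAt (Label.actℕ z y) c) (sym (desc-∷ʳ 0 c)))
  (trans (cong (λ z → entryAt z c) (Label.actℕ-++ (desc 1 c) [ 0 ] y))
    (trans (entryAt-desc 0 c (Label.negateHead y) (subst (c <_) (sym (Label.length-gen 0 y)) c<y)) (entryAt-negateHead-zero y)))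

top : ℕ → ℕ → List Labelled → Maybe Labelled
top k r y = entryAt (Label.actℕ (coset (suc k) r) y) k

-- The top entry after acting by a coset representative is the entry at position t of the
-- original list, negated exactly when r > k.
TopCase : ℕ → ℕ → List Labelled → ℕ → Set
TopCase k r y t = r + t ≡ k × top k r y ≡ entryAt y t ⊎ r ≡ suc k + t × top k r y ≡ Maybe.map flipSign (entryAt y t)

TopEntry : ℕ → ℕ → List Labelled → Set
TopEntry k r y = ∃ λ t → t ≤ k × TopCase k r y t

top-entry : ∀ k r y → r < suc k + suc k → suc k ≤ length y → TopEntry k r y
top-entry k r y r<2k k<y with cosetView (suc k) r
... | short zero 1+k≡r = 0 , z≤n , inj₂ (trans (sym 1+k≡r) (sym (+-identityʳ (suc k))) , (begin
  top k r y                                          ≡⟨ cong (λ z → top k z y) (sym 1+k≡r) ⟩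
  top k (suc k) y                                    ≡⟨ cong (λ z → entryAt (Label.actℕ z y) k) (coset-short 0 (suc k)) ⟩
  entryAt (Label.actℕ (desc 0 (suc k)) y) k          ≡⟨ entryAt-desc-0 k y k<y ⟩
  Maybe.map flipSign (entryAt y 0)                   ∎))
  where open ≡-Reasoning
... | short (suc l) 1+k≡1+l+r = l , subst (l ≤_) l+r≡k (m≤m+n l r) , inj₁ (trans (+-comm r l) l+r≡k , (begin
  top k r y                                          ≡⟨ cong (λ z → entryAt (Label.actℕ (coset z r) y) k) 1+k≡1+l+r ⟩
  entryAt (Label.actℕ (coset (suc l + r) r) y) k     ≡⟨ cong (λ z → entryAt (Label.actℕ z y) k) (coset-short (suc l) r) ⟩
  entryAt (Label.actℕ (desc (suc l) r) y) k          ≡⟨ cong (entryAt (Label.actℕ (desc (suc l) r) y)) (sym l+r≡k) ⟩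
  entryAt (Label.actℕ (desc (suc l) r) y) (l + r)    ≡⟨ entryAt-desc l r y (subst (_< length y) (sym l+r≡k) k<y) ⟩
  entryAt y l                                        ∎))
  where
  open ≡-Reasoning
  l+r≡k : l + r ≡ k
  l+r≡k = suc-injective (sym 1+k≡1+l+r)
... | long j r≡k+2+j = suc j , 1+j≤k , inj₂ (r≡k+2+j , (begin
  top k r y                                                              ≡⟨ cong (λ z → top k z y) r≡k+2+j ⟩
  entryAt (Label.actℕ (coset (suc k) (suc k + suc j)) y) k               ≡⟨ cong (λ z → entryAt (Label.actℕ z y) k) (coset-long (suc k) (suc j)) ⟩
  entryAt (Label.actℕ (desc 0 (suc k) ++ asc 1 (suc j)) y) k             ≡⟨ cong (λ z → entryAt z k) (Label.actℕ-++ (desc 0 (suc k)) (asc 1 (suc j)) y) ⟩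
  entryAt (Label.actℕ (desc 0 (suc k)) (Label.actℕ (asc 1 (suc j)) y)) k ≡⟨ entryAt-desc-0 k _ (subst (k <_) (sym (Label.length-actℕ (asc 1 (suc j)) y)) k<y) ⟩
  Maybe.map flipSign (entryAt (Label.actℕ (asc 1 (suc j)) y) 0)          ≡⟨ cong (Maybe.map flipSign) (entryAt-asc 0 (suc j) y (<-≤-trans (s≤s 1+j≤k) k<y)) ⟩
  Maybe.map flipSign (entryAt y (suc j))                                 ∎))
  where
  open ≡-Reasoning
  1+j≤k : suc j ≤ k
  1+j≤k = ≤-pred (+-cancelˡ-< (suc k) (suc j) (suc k) (subst (_< suc k + suc k) r≡k+2+j r<2k))

Distinct : List Labelled → Set
Distinct y = ∀ p q x x′ → entryAt y p ≡ just x → entryAt y q ≡ just x′ → proj₂ x ≡ proj₂ x′ → p ≡ q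

top-label : ∀ {k r y t x} → entryAt y t ≡ just x → TopCase k r y t → Maybe.map proj₂ (top k r y) ≡ just (proj₂ x)
top-label y[t] (inj₁ (_ , top≡)) = cong (Maybe.map proj₂) (trans top≡ y[t])
top-label y[t] (inj₂ (_ , top≡)) = cong (Maybe.map proj₂) (trans top≡ (cong (Maybe.map flipSign) y[t]))

-- The label of the top entry recovers t, and its sign tells which of the two formulas gives r.
top-entry-injective : ∀ k r r′ y → r < suc k + suc k → r′ < suc k + suc k → suc k ≤ length y → Distinct y →
  top k r y ≡ top k r′ y → r ≡ r′
top-entry-injective k r r′ y r<2k r′<2k k<y distinct top≡top′
  with top-entry k r y r<2k k<y | top-entry k r′ y r′<2k k<y
... | t , t≤k , case | t′ , t′≤k , case′
  with entryAt-defined y t (<-≤-trans (s≤s t≤k) k<y) | entryAt-defined y t′ (<-≤-trans (s≤s t′≤k) k<y)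
... | x , y[t] | x′ , y[t′] with distinct t t′ x x′ y[t] y[t′]
       (just-injective (trans (sym (top-label y[t] case)) (trans (cong (Maybe.map proj₂) top≡top′) (top-label y[t′] case′))))
... | refl with trans (sym y[t]) y[t′]
... | refl = compare case case′
  where
  compare : TopCase k r y t → TopCase k r′ y t → r ≡ r′
  compare (inj₁ (r+t≡k , _)) (inj₁ (r′+t≡k , _)) = +-cancelʳ-≡ t r r′ (trans r+t≡k (sym r′+t≡k))
  compare (inj₂ (r≡ , _)) (inj₂ (r′≡ , _)) = trans r≡ (sym r′≡)
  compare (inj₁ (_ , top≡)) (inj₂ (_ , top′≡)) =
    ⊥-elim (not-¬ refl (cong proj₁ (just-injective (trans (sym y[t]) (trans (sym top≡) (trans top≡top′ (trans top′≡ (cong (Maybe.map flipSign) y[t]))))))))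
  compare (inj₂ (_ , top≡)) (inj₁ (_ , top′≡)) =
    ⊥-elim (not-¬ refl (cong proj₁ (just-injective (trans (sym y[t]) (trans (sym top′≡) (trans (sym top≡top′) (trans top≡ (cong (Maybe.map flipSign) y[t]))))))))

Distinct-swap : ∀ q y → suc q < length y → Distinct y → Distinct (Label.swap q y)
Distinct-swap q y 1+q<y distinct p p′ x x′ y[p] y[p′] label≡ =
  trans (sym (swapIndex-involutive q p))
        (trans (cong (swapIndex q) (distinct (swapIndex q p) (swapIndex q p′) x x′
                                      (trans (sym (entryAt-swap q y 1+q<y p)) y[p]) (trans (sym (entryAt-swap q y 1+q<y p′)) y[p′]) label≡))
               (swapIndex-involutive q p′))

entryAt-negateHead-label : ∀ y p x → entryAt (Label.negateHead y) p ≡ just x → ∃ λ x₀ → entryAt y p ≡ just x₀ × proj₂ x₀ ≡ proj₂ x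
entryAt-negateHead-label (z ∷ y) zero x y[0] = z , refl , cong proj₂ (just-injective y[0])
entryAt-negateHead-label (z ∷ y) (suc p) x y[p] = x , y[p] , refl

Distinct-negateHead : ∀ y → Distinct y → Distinct (Label.negateHead y)
Distinct-negateHead y distinct p p′ x x′ y[p] y[p′] label≡
  with entryAt-negateHead-label y p x y[p] | entryAt-negateHead-label y p′ x′ y[p′]
... | x₀ , y₀[p] , label₀≡ | x₁ , y₀[p′] , label₁≡ = distinct p p′ x₀ x₁ y₀[p] y₀[p′] (trans label₀≡ (trans label≡ (sym label₁≡)))

Distinct-gen : ∀ c y → c < length y → Distinct y → Distinct (Label.gen c y)
Distinct-gen zero y _ = Distinct-negateHead y
Distinct-gen (suc q) y 1+q<y = Distinct-swap q y 1+q<y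

Distinct-actℕ : ∀ w y → All (_< length y) w → Distinct y → Distinct (Label.actℕ w y)
Distinct-actℕ [] y _ distinct = distinct
Distinct-actℕ (c ∷ w) y (c<y ∷ w<y) distinct =
  Distinct-gen c (Label.actℕ w y) (subst (c <_) (sym (Label.length-actℕ w y)) c<y) (Distinct-actℕ w y w<y distinct)

-- The top entry determines the last coset representative; then induct on the rest of the code.
act-nf-injective : ∀ d d′ y → Code d → Code d′ → length d ≡ length d′ → length d ≤ length y → Distinct y →
  Label.actℕ (nf d) y ≡ Label.actℕ (nf d′) y → d ≡ d′
act-nf-injective [] [] y _ _ _ _ _ _ = refl
act-nf-injective (r ∷ rest) (r′ ∷ rest′) y (r<2k , code) (r′<2k′ , code′) d≡d′ d≤y distinct act≡ =
  cong₂ _∷_ r≡r′ rest≡rest′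
  where
  k = length rest
  rest≡ : length rest ≡ length rest′
  rest≡ = suc-injective d≡d′
  act-rest≡ : Label.actℕ (nf rest) (Label.actℕ (coset (suc k) r) y) ≡ Label.actℕ (nf rest′) (Label.actℕ (coset (suc k) r′) y)
  act-rest≡ = trans (sym (Label.actℕ-++ (nf rest) (coset (suc k) r) y))
                    (trans act≡ (trans (Label.actℕ-++ (nf rest′) (coset (suc (length rest′)) r′) y)
                                       (cong (λ l → Label.actℕ (nf rest′) (Label.actℕ (coset (suc l) r′) y)) (sym rest≡))))
  top≡top′ : top k r y ≡ top k r′ y
  top≡top′ = trans (sym (entryAt-actℕ-below (nf rest) _ k (nf-letters rest code)))
               (trans (cong (λ z → entryAt z k) act-rest≡)
                      (entryAt-actℕ-below (nf rest′) _ k (subst (λ l → All (_< l) (nf rest′)) (sym rest≡) (nf-letters rest′ code′))))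
  r≡r′ : r ≡ r′
  r≡r′ = top-entry-injective k r r′ y r<2k (subst (λ l → r′ < suc l + suc l) (sym rest≡) r′<2k′) d≤y distinct top≡top′
  y′ = Label.actℕ (coset (suc k) r) y
  rest≡rest′ : rest ≡ rest′
  rest≡rest′ =
    act-nf-injective rest rest′ y′ code code′ rest≡
      (subst (k ≤_) (sym (Label.length-actℕ (coset (suc k) r) y)) (≤-trans (n≤1+n k) d≤y))
      (Distinct-actℕ (coset (suc k) r) y (All.map (λ x<k → <-≤-trans x<k d≤y) (coset-letters (suc k) r r<2k)) distinct)
      (trans act-rest≡ (cong (λ q → Label.actℕ (nf rest′) (Label.actℕ (coset (suc k) q) y)) (sym r≡r′)))

initial : ℕ → ℕ → List Labelled
initial o zero = []
initial o (suc k) = (false , o) ∷ initial (suc o) k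

length-initial : ∀ o k → length (initial o k) ≡ k
length-initial o zero = refl
length-initial o (suc k) = cong suc (length-initial (suc o) k)

entryAt-initial : ∀ o k p x → entryAt (initial o k) p ≡ just x → proj₂ x ≡ o + p
entryAt-initial o (suc k) zero x y[0] = trans (cong proj₂ (sym (just-injective y[0]))) (sym (+-identityʳ o))
entryAt-initial o (suc k) (suc p) x y[p] = trans (entryAt-initial (suc o) k p x y[p]) (sym (+-suc o p))

Distinct-initial : ∀ o k → Distinct (initial o k)
Distinct-initial o k p q x x′ y[p] y[q] label≡ =
  +-cancelˡ-≡ o p q (trans (sym (entryAt-initial o k p x y[p])) (trans label≡ (entryAt-initial o k q x′ y[q])))

≤-offset : ∀ r k → r ≤ k → ∃ λ m → k ≡ m + r
≤-offset zero k _ = k , sym (+-identityʳ k)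
≤-offset (suc r) (suc k) (s≤s r≤k) with ≤-offset r k r≤k
... | m , k≡m+r = m , trans (cong suc k≡m+r) (sym (+-suc m r))

module _ (n₀ : ℕ) where

  private
    n : ℕ
    n = suc n₀

  -- Letters are given as numbers; out-of-range numbers become the junk letter s_0.
  letter : ℕ → Fin n
  letter j with j <? n
  ... | yes j<n = fromℕ< j<n
  ... | no _ = Fin.zero

  toℕ-letter : ∀ {j} → j < n → toℕ (letter j) ≡ j
  toℕ-letter {j} j<n with j <? n
  ... | yes j<n′ = toℕ-fromℕ< j<n′
  ... | no j≮n = ⊥-elim (j≮n j<n)

  letter-toℕ : ∀ (c : Fin n) → letter (toℕ c) ≡ c
  letter-toℕ c = toℕ-injective (toℕ-letter (toℕ<n c))

  ⟦_⟧ : List ℕ → Word n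
  ⟦_⟧ = map letter

  map-toℕ-⟦⟧ : ∀ xs → All (_< n) xs → map toℕ ⟦ xs ⟧ ≡ xs
  map-toℕ-⟦⟧ [] _ = refl
  map-toℕ-⟦⟧ (x ∷ xs) (x<n ∷ xs<n) = cong₂ _∷_ (toℕ-letter x<n) (map-toℕ-⟦⟧ xs xs<n)

  infix 4 _∼_
  record _∼_ (xs ys : List ℕ) : Set where
    constructor ⟨_⟩
    field unwrap : ⟦ xs ⟧ ≈ ⟦ ys ⟧
  open _∼_

  ∼-reflexive : ∀ {xs ys} → xs ≡ ys → xs ∼ ys
  ∼-reflexive refl = ⟨ ≈refl ⟩

  ∼-setoid : Setoid 0ℓ 0ℓ
  ∼-setoid = record
    { Carrier = List ℕ
    ; _≈_ = _∼_
    ; isEquivalence = record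
      { refl = ⟨ ≈refl ⟩
      ; sym = λ p → ⟨ ≈sym (unwrap p) ⟩
      ; trans = λ p q → ⟨ ≈trans (unwrap p) (unwrap q) ⟩
      }
    }

  open Setoid ∼-setoid public using () renaming (refl to ∼-refl; sym to ∼-sym; trans to ∼-trans)

  ∼-inside : ∀ {xs ys} (us vs : List ℕ) → xs ∼ ys → (us ++ xs ++ vs) ∼ (us ++ ys ++ vs)
  ∼-inside {xs} {ys} us vs ⟨ p ⟩ = ⟨ ≈-subst (sym (⟦⟧-++ xs)) (sym (⟦⟧-++ ys)) (≈-inside ⟦ us ⟧ ⟦ vs ⟧ p) ⟩
    where
    ⟦⟧-++ : ∀ zs → ⟦ us ++ zs ++ vs ⟧ ≡ ⟦ us ⟧ ++ ⟦ zs ⟧ ++ ⟦ vs ⟧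
    ⟦⟧-++ zs = trans (map-++ letter us (zs ++ vs)) (cong (⟦ us ⟧ ++_) (map-++ letter zs vs))

  ∼-++⁺ˡ : ∀ {xs ys} (us : List ℕ) → xs ∼ ys → (us ++ xs) ∼ (us ++ ys)
  ∼-++⁺ˡ {xs} {ys} us p =
    ∼-trans (∼-reflexive (cong (us ++_) (sym (++-identityʳ xs))))
            (∼-trans (∼-inside us [] p) (∼-reflexive (cong (us ++_) (++-identityʳ ys))))

  ∼-++⁺ʳ : ∀ {xs ys} (vs : List ℕ) → xs ∼ ys → (xs ++ vs) ∼ (ys ++ vs)
  ∼-++⁺ʳ vs p = ∼-inside [] vs p

  involutionℕ : ∀ i → (i ∷ i ∷ []) ∼ []
  involutionℕ i = ⟨ involution (letter i) ⟩

  commuteℕ : ∀ i j → i < n → j < n → Far i j → (i ∷ j ∷ []) ∼ (j ∷ i ∷ [])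
  commuteℕ i j i<n j<n far = ⟨ commute (letter i) (letter j) (far′ far) ⟩
    where
    far′ : Far i j → Far (toℕ (letter i)) (toℕ (letter j))
    far′ = subst₂ Far (sym (toℕ-letter i<n)) (sym (toℕ-letter j<n))

  braid₃ℕ : ∀ i → 1 ≤ i → suc i < n → (i ∷ suc i ∷ i ∷ []) ∼ (suc i ∷ i ∷ suc i ∷ [])
  braid₃ℕ i 1≤i 1+i<n = ⟨ braid₃ (letter i) (letter (suc i)) (subst (1 ≤_) (sym i≡) 1≤i)
                                 (trans (toℕ-letter 1+i<n) (cong suc (sym i≡))) ⟩
    where
    i≡ : toℕ (letter i) ≡ i
    i≡ = toℕ-letter (<-trans (n<1+n i) 1+i<n)

  braid₄ℕ : 1 < n → (1 ∷ 0 ∷ 1 ∷ 0 ∷ []) ∼ (0 ∷ 1 ∷ 0 ∷ 1 ∷ [])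
  braid₄ℕ 1<n = ⟨ ≈sym (braid₄ (letter 0) (letter 1) (toℕ-letter (s≤s z≤n)) (toℕ-letter 1<n)) ⟩

  commute-past : ∀ i us → i < n → All (_< n) us → All (Far i) us → (us ++ [ i ]) ∼ (i ∷ us)
  commute-past i [] _ _ _ = ∼-refl
  commute-past i (u ∷ us) i<n (u<n ∷ us<n) (far ∷ fars) =
    ∼-trans (∼-++⁺ˡ [ u ] (commute-past i us i<n us<n fars)) (∼-inside [] us (commuteℕ u i u<n i<n (Far-sym far)))

  module ∼-Reasoning = SetoidReasoning ∼-setoid

  slide-braid₃ : ∀ X Y i → 1 ≤ i → suc i < n → All (_< n) X → All (_< n) Y → All (Far (suc i)) Y → All (Far i) X →
        (X ++ (suc i ∷ i ∷ Y)) ++ [ suc i ] ∼ i ∷ (X ++ (suc i ∷ i ∷ Y))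
  slide-braid₃ X Y i 1≤i 1+i<n X<n Y<n Y-far X-far = begin
    (X ++ (suc i ∷ i ∷ Y)) ++ [ suc i ]       ≡⟨ ++-assoc X (suc i ∷ i ∷ Y) [ suc i ] ⟩
    X ++ (suc i ∷ i ∷ (Y ++ [ suc i ]))       ≈⟨ ∼-++⁺ˡ X (∼-++⁺ˡ (suc i ∷ i ∷ []) (commute-past (suc i) Y 1+i<n Y<n Y-far)) ⟩
    X ++ (suc i ∷ i ∷ suc i ∷ Y)              ≈⟨ ∼-inside X Y (∼-sym (braid₃ℕ i 1≤i 1+i<n)) ⟩
    X ++ (i ∷ suc i ∷ i ∷ Y)                  ≡⟨ sym (++-assoc X [ i ] (suc i ∷ i ∷ Y)) ⟩
    (X ++ [ i ]) ++ (suc i ∷ i ∷ Y)           ≈⟨ ∼-++⁺ʳ (suc i ∷ i ∷ Y) (commute-past i X (<-trans (n<1+n i) 1+i<n) X<n X-far) ⟩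
    i ∷ (X ++ (suc i ∷ i ∷ Y))  ∎
    where open ∼-Reasoning

  slide-double-braid₃ : ∀ A BC D i → 1 ≤ i → suc i < n → All (_< n) A → All (_< n) BC → All (_< n) D →
        All (Far i) A → All (Far (suc i)) BC → All (Far i) D →
        (A ++ (suc i ∷ i ∷ (BC ++ (i ∷ suc i ∷ D)))) ++ [ i ] ∼ i ∷ (A ++ (suc i ∷ i ∷ (BC ++ (i ∷ suc i ∷ D))))
  slide-double-braid₃ A BC D i 1≤i 1+i<n A<n BC<n D<n A-far BC-far D-far = begin
    (A ++ (s ∷ i ∷ (BC ++ (i ∷ s ∷ D)))) ++ [ i ]  ≡⟨ trans (++-assoc A (s ∷ i ∷ (BC ++ (i ∷ s ∷ D))) [ i ])
                                                         (cong (λ z → A ++ (s ∷ i ∷ z)) (++-assoc BC (i ∷ s ∷ D) [ i ])) ⟩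
    A ++ (s ∷ i ∷ (BC ++ (i ∷ s ∷ (D ++ [ i ]))))   ≈⟨ ∼-++⁺ˡ A (∼-++⁺ˡ (s ∷ i ∷ []) (∼-++⁺ˡ BC (∼-++⁺ˡ (i ∷ s ∷ []) (commute-past i D i<n D<n D-far)))) ⟩
    A ++ (s ∷ i ∷ (BC ++ (i ∷ s ∷ i ∷ D)))          ≈⟨ ∼-++⁺ˡ A (∼-++⁺ˡ (s ∷ i ∷ []) (∼-inside BC D (braid₃ℕ i 1≤i 1+i<n))) ⟩
    A ++ (s ∷ i ∷ (BC ++ (s ∷ i ∷ s ∷ D)))          ≡⟨ cong (λ z → A ++ (s ∷ i ∷ z)) (sym (++-assoc BC [ s ] (i ∷ s ∷ D))) ⟩
    A ++ (s ∷ i ∷ ((BC ++ [ s ]) ++ (i ∷ s ∷ D)))   ≈⟨ ∼-++⁺ˡ A (∼-++⁺ˡ (s ∷ i ∷ []) (∼-++⁺ʳ (i ∷ s ∷ D) (commute-past s BC 1+i<n BC<n BC-far))) ⟩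
    A ++ (s ∷ i ∷ s ∷ (BC ++ (i ∷ s ∷ D)))          ≈⟨ ∼-inside A (BC ++ (i ∷ s ∷ D)) (∼-sym (braid₃ℕ i 1≤i 1+i<n)) ⟩
    A ++ (i ∷ s ∷ i ∷ (BC ++ (i ∷ s ∷ D)))          ≡⟨ sym (++-assoc A [ i ] (s ∷ i ∷ (BC ++ (i ∷ s ∷ D)))) ⟩
    (A ++ [ i ]) ++ (s ∷ i ∷ (BC ++ (i ∷ s ∷ D)))   ≈⟨ ∼-++⁺ʳ (s ∷ i ∷ (BC ++ (i ∷ s ∷ D))) (commute-past i A i<n A<n A-far) ⟩
    i ∷ (A ++ (s ∷ i ∷ (BC ++ (i ∷ s ∷ D))))  ∎
    where
    open ∼-Reasoning
    s = suc i
    i<n : i < n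
    i<n = <-trans (n<1+n i) 1+i<n

  slide-braid₄ : ∀ X D → 1 < n → All (_< n) X → All (_< n) D → All (Far 0) X → All (Far 0) D →
        (X ++ (1 ∷ 0 ∷ 1 ∷ D)) ++ [ 0 ] ∼ 0 ∷ (X ++ (1 ∷ 0 ∷ 1 ∷ D))
  slide-braid₄ X D 1<n X<n D<n X-far D-far = begin
    (X ++ (1 ∷ 0 ∷ 1 ∷ D)) ++ [ 0 ]  ≡⟨ ++-assoc X (1 ∷ 0 ∷ 1 ∷ D) [ 0 ] ⟩
    X ++ (1 ∷ 0 ∷ 1 ∷ (D ++ [ 0 ]))  ≈⟨ ∼-++⁺ˡ X (∼-++⁺ˡ (1 ∷ 0 ∷ 1 ∷ []) (commute-past 0 D (s≤s z≤n) D<n D-far)) ⟩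
    X ++ (1 ∷ 0 ∷ 1 ∷ 0 ∷ D)         ≈⟨ ∼-inside X D (braid₄ℕ 1<n) ⟩
    X ++ (0 ∷ 1 ∷ 0 ∷ 1 ∷ D)         ≡⟨ sym (++-assoc X [ 0 ] (1 ∷ 0 ∷ 1 ∷ D)) ⟩
    (X ++ [ 0 ]) ++ (1 ∷ 0 ∷ 1 ∷ D)  ≈⟨ ∼-++⁺ʳ (1 ∷ 0 ∷ 1 ∷ D) (commute-past 0 X (s≤s z≤n) X<n X-far) ⟩
    0 ∷ (X ++ (1 ∷ 0 ∷ 1 ∷ D))  ∎
    where open ∼-Reasoning

  data Push (k r i : ℕ) : Set where
    extend  : suc r < k + k → coset k r ++ [ i ] ≡ coset k (suc r) → Push k r i
    cancel  : ∀ r′ → r ≡ suc r′ → (coset k r ++ [ i ]) ∼ coset k r′ → Push k r i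
    pass    : ∀ i′ → suc i′ < k → (coset k r ++ [ i ]) ∼ (i′ ∷ coset k r) → Push k r i

  push-short-braid : ∀ m a b → 1 ≤ a + m → m + (b + suc (suc a)) ≤ n → Push (m + (b + suc (suc a))) (b + suc (suc a)) (suc (a + m))
  push-short-braid m a b 1≤i k≤n = pass i (≤-trans (m≤m+n (suc (suc i)) b) i+2+b≤k) (subst (λ z → (z ++ [ suc i ]) ∼ (i ∷ z)) (sym coset≡)
          (slide-braid₃ X Y i 1≤i (<k⇒<n (suc i) (≤-trans (m≤m+n (suc (suc i)) b) i+2+b≤k)) X<n Y<n Y-far X-far))
    where
    i = a + m
    X = desc (suc (suc i)) b
    Y = desc m a
    coset≡ : coset (m + (b + suc (suc a))) (b + suc (suc a)) ≡ X ++ (suc i ∷ i ∷ Y)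
    coset≡ = trans (coset-short m (b + suc (suc a))) (trans (desc-+ m b (suc (suc a)))
            (cong₂ (λ u v → desc u b ++ v) (trans (+-suc m (suc a)) (cong suc (trans (+-suc m a) (cong suc (+-comm m a)))))
               (cong₂ (λ u v → u ∷ v ∷ Y) (trans (+-suc m a) (cong suc (+-comm m a))) (+-comm m a))))
    k = m + (b + suc (suc a))
    <k⇒<n : ∀ x → x < k → x < n
    <k⇒<n x p = <-≤-trans p k≤n
    i+2+b≤k : suc (suc i) + b ≤ k
    i+2+b≤k = ≤-reflexive (sym (trans (cong (m +_) (+-comm b (suc (suc a)))) (trans (sym (+-assoc m (suc (suc a)) b))
             (cong (_+ b) (trans (+-suc m (suc a)) (cong suc (trans (+-suc m a) (cong suc (+-comm m a)))))))))
    X<n : All (_< n) X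
    X<n = All-desc _ (suc (suc i)) b (λ x _ p → <k⇒<n x (<-≤-trans p i+2+b≤k))
    Y<n : All (_< n) Y
    Y<n = All-desc _ m a (λ x _ p → <k⇒<n x (<-trans (subst (x <_) (+-comm m a) p) (<-trans (n<1+n i) (≤-trans (n<1+n (suc i)) i+2≤k))))
      where
      i+2≤k : suc (suc i) ≤ k
      i+2≤k = ≤-trans (m≤m+n (suc (suc i)) b) i+2+b≤k
    Y-far : All (Far (suc i)) Y
    Y-far = All-desc _ m a (λ x _ p → inj₂ (s≤s (subst (x <_) (+-comm m a) p)))
    X-far : All (Far i) X
    X-far = All-desc _ (suc (suc i)) b (λ x q _ → inj₁ q)

  push-short : ∀ m r i → i < m + r → m + r ≤ n → Push (m + r) r i
  push-short m r i i<k k≤n with <-cmp i m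
  ... | tri< i<m _ _ with m≤n⇒m<n∨m≡n i<m
  ...   | inj₂ refl = extend (s≤s (≤-trans (s≤s (m≤n+m r i)) (m≤n+m (suc (i + r)) (i + r))))
            (trans (cong (_++ [ i ]) (coset-short (suc i) r)) (trans (desc-∷ʳ i r)
               (sym (trans (cong (λ z → coset z (suc r)) (sym (+-suc i r))) (coset-short i (suc r))))))
  ...   | inj₁ 1+i<m = pass i (<-≤-trans 1+i<m (m≤m+n m r))
            (subst (λ z → (z ++ [ i ]) ∼ (i ∷ z)) (sym (coset-short m r))
              (commute-past i (desc m r) (<-≤-trans i<k k≤n)
                (All-desc _ m r (λ x _ b → <-≤-trans b k≤n))
                (All-desc _ m r (λ x a _ → inj₁ (≤-trans 1+i<m a)))))
  push-short m zero i i<k k≤n | tri≈ _ refl _ = ⊥-elim (<-irrefl refl (subst (i <_) (+-identityʳ i) i<k))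
  push-short m (suc r′) i i<k k≤n | tri≈ _ refl _ = cancel r′ refl
    (subst₂ (λ u v → (u ++ [ i ]) ∼ v) (sym (coset-short i (suc r′)))
       (sym (trans (cong (λ z → coset z r′) (+-suc i r′)) (coset-short (suc i) r′)))
       (begin desc i (suc r′) ++ [ i ]                   ≡⟨ cong (_++ [ i ]) (sym (desc-∷ʳ i r′)) ⟩
        (desc (suc i) r′ ++ [ i ]) ++ [ i ]          ≡⟨ ++-assoc (desc (suc i) r′) [ i ] [ i ] ⟩
        desc (suc i) r′ ++ (i ∷ i ∷ [])              ≈⟨ ∼-++⁺ˡ (desc (suc i) r′) (involutionℕ i) ⟩
        desc (suc i) r′ ++ []                        ≡⟨ ++-identityʳ (desc (suc i) r′) ⟩
        desc (suc i) r′  ∎))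
    where open ∼-Reasoning
  push-short m r (suc zero) i<k k≤n | tri> _ _ (s≤s z≤n) =
    extend (1+r<2r r i<k) (trans (cong (_++ [ 1 ]) (coset-short 0 r)) (sym (trans (cong (coset r) (+-comm 1 r)) (coset-long r 1))))
    where
    1+r<2r : ∀ r → 1 < r → suc r < r + r
    1+r<2r (suc (suc r)) _ = s≤s (s≤s (m≤n+m (suc (suc r)) r))
    1+r<2r (suc zero) (s≤s ())
  push-short m r (suc (suc i1)) i<k k≤n | tri> _ _ m<i with ≤-offset m (suc i1) (≤-pred m<i)
  ... | a , 1+i≡a+m with ≤-offset (suc (suc a)) r (+-cancelˡ-≤ m (suc (suc a)) r (subst (_≤ m + r) (sym (trans (+-suc m (suc a)) (cong suc (trans (+-suc m a) (cong suc (trans (+-comm m a) (sym 1+i≡a+m))))))) i<k))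
  ... | b , refl = subst (λ z → Push (m + (b + suc (suc a))) (b + suc (suc a)) (suc z)) (sym 1+i≡a+m)
                    (push-short-braid m a b (subst (1 ≤_) 1+i≡a+m (s≤s z≤n)) k≤n)

  push-long-braid₃ : ∀ b i j → suc j < i → b + suc (suc i) ≤ n → Push (b + suc (suc i)) ((b + suc (suc i)) + suc j) (suc i)
  push-long-braid₃ b i j 1+j<i k≤n = pass i (m≤n+m (suc (suc i)) b)
     (subst (λ z → (z ++ [ suc i ]) ∼ (i ∷ z)) (sym coset≡)
       (slide-braid₃ X Y i (≤-trans (s≤s z≤n) 1+j<i) (<k⇒<n (suc i) (m≤n+m (suc (suc i)) b)) X<n Y<n Y-far X-far))
    where
    k = b + suc (suc i)
    X = desc (suc (suc i)) b
    Y = desc 0 i ++ asc 1 (suc j)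
    <k⇒<n : ∀ x → x < k → x < n
    <k⇒<n x p = <-≤-trans p k≤n
    coset≡ : coset k (k + suc j) ≡ X ++ (suc i ∷ i ∷ Y)
    coset≡ = trans (coset-long k (suc j)) (trans (cong (_++ asc 1 (suc j)) (desc-+ 0 b (suc (suc i))))
            (++-assoc X (suc i ∷ i ∷ desc 0 i) (asc 1 (suc j))))
    X<n : All (_< n) X
    X<n = All-desc _ (suc (suc i)) b (λ x _ p → <k⇒<n x (subst (x <_) (+-comm (suc (suc i)) b) p))
    X-far : All (Far i) X
    X-far = All-desc _ (suc (suc i)) b (λ x q _ → inj₁ q)
    i<k : i < k
    i<k = ≤-trans (n≤1+n (suc i)) (m≤n+m (suc (suc i)) b)
    Y<n : All (_< n) Y
    Y<n = All.++⁺ (All-desc _ 0 i (λ x _ p → <k⇒<n x (<-trans p i<k)))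
                  (All-asc _ 1 (suc j) (λ x _ p → <k⇒<n x (<-trans (<-≤-trans p 1+j<i) i<k)))
    Y-far : All (Far (suc i)) Y
    Y-far = All.++⁺ (All-desc _ 0 i (λ x _ p → inj₂ (s≤s p)))
                  (All-asc _ 1 (suc j) (λ x _ p → inj₂ (s≤s (<-≤-trans p 1+j<i))))

  push-long-double-braid₃ : ∀ b c i1 → i1 + suc (suc c) < b + suc (suc (suc i1)) → b + suc (suc (suc i1)) ≤ n →
    Push (b + suc (suc (suc i1))) ((b + suc (suc (suc i1))) + (i1 + suc (suc c))) (suc i1)
  push-long-double-braid₃ b c i1 1+j<k k≤n = pass i (m≤n+m (suc (suc i)) b)
     (subst (λ z → (z ++ [ i ]) ∼ (i ∷ z)) (sym coset≡)
       (slide-double-braid₃ A BC D i (s≤s z≤n) (<k⇒<n (suc i) (m≤n+m (suc (suc i)) b)) A<n BC<n D<n A-far BC-far D-far))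
    where
    i = suc i1
    s = suc i
    k = b + suc (suc i)
    A = desc (suc s) b
    B = desc 0 i
    C = asc 1 i1
    D = asc (suc s) c
    BC = B ++ C
    <k⇒<n : ∀ x → x < k → x < n
    <k⇒<n x p = <-≤-trans p k≤n
    coset≡ : coset k (k + (i1 + suc (suc c))) ≡ A ++ (s ∷ i ∷ (BC ++ (i ∷ s ∷ D)))
    coset≡ = trans (coset-long k (i1 + suc (suc c)))
           (trans (cong₂ _++_ (desc-+ 0 b (suc (suc i))) (asc-+ 1 i1 (suc (suc c))))
            (trans (++-assoc A (s ∷ i ∷ B) (C ++ (i ∷ s ∷ D)))
              (cong (λ z → A ++ (s ∷ i ∷ z)) (sym (++-assoc B C (i ∷ s ∷ D))))))
    s<k : s < k
    s<k = m≤n+m (suc (suc i)) b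
    A<n : All (_< n) A
    A<n = All-desc _ (suc s) b (λ x _ p → <k⇒<n x (subst (x <_) (+-comm (suc s) b) p))
    A-far : All (Far i) A
    A-far = All-desc _ (suc s) b (λ x q _ → inj₁ q)
    BC<n : All (_< n) BC
    BC<n = All.++⁺ (All-desc _ 0 i (λ x _ p → <k⇒<n x (<-trans p (<-trans (n<1+n i) s<k))))
                   (All-asc _ 1 i1 (λ x _ p → <k⇒<n x (<-trans p (<-trans (n<1+n i) s<k))))
    BC-far : All (Far s) BC
    BC-far = All.++⁺ (All-desc _ 0 i (λ x _ p → inj₂ (s≤s p))) (All-asc _ 1 i1 (λ x _ p → inj₂ (s≤s p)))
    D<n : All (_< n) D
    D<n = All-asc _ (suc s) c (λ x _ p → <k⇒<n x (<-≤-trans (subst (x <_) e p) 1+j<k))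
      where
      e : suc s + c ≡ suc (i1 + suc (suc c))
      e = cong suc (sym (trans (+-suc i1 (suc c)) (cong suc (+-suc i1 c))))
    D-far : All (Far i) D
    D-far = All-asc _ (suc s) c (λ x q _ → inj₁ q)

  push-long-braid₄ : ∀ k2 j → suc j < suc (suc k2) → suc (suc k2) ≤ n → Push (suc (suc k2)) (suc (suc k2) + suc j) 0
  push-long-braid₄ k2 j 1+j<k k≤n = pass 0 (s≤s (s≤s z≤n))
    (subst (λ z → (z ++ [ 0 ]) ∼ (0 ∷ z)) (sym coset≡) (slide-braid₄ X D (<-≤-trans (s≤s (s≤s z≤n)) k≤n) X<n D<n X-far D-far))
    where
    k = suc (suc k2)
    X = desc 2 k2
    D = asc 2 j
    coset≡ : coset k (k + suc j) ≡ X ++ (1 ∷ 0 ∷ 1 ∷ D)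
    coset≡ = trans (coset-long k (suc j)) (trans (cong (_++ (1 ∷ D)) (trans (cong (desc 0) (+-comm 2 k2)) (desc-+ 0 k2 2)))
            (++-assoc X (1 ∷ 0 ∷ []) (1 ∷ D)))
    X<n : All (_< n) X
    X<n = All-desc _ 2 k2 (λ x _ p → <-≤-trans p k≤n)
    D<n : All (_< n) D
    D<n = All-asc _ 2 j (λ x _ p → <-≤-trans (<-≤-trans p 1+j<k) k≤n)
    X-far : All (Far 0) X
    X-far = All-desc _ 2 k2 (λ x q _ → inj₁ q)
    D-far : All (Far 0) D
    D-far = All-asc _ 2 j (λ x q _ → inj₁ q)

  push-long : ∀ k j i → suc j < k → i < k → k ≤ n → Push k (k + suc j) i
  push-long k j i 1+j<k i<k k≤n with <-cmp i (suc j)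
  ... | tri≈ _ refl _ = cancel (k + j) (+-suc k j)
    (subst₂ (λ u v → (u ++ [ suc j ]) ∼ v) (sym (coset-long k (suc j))) (sym (coset-long k j))
      (begin (desc 0 k ++ asc 1 (suc j)) ++ [ suc j ]  ≡⟨ trans (cong (λ z → (desc 0 k ++ z) ++ [ suc j ]) (sym (asc-∷ʳ 1 j)))
                                                     (trans (++-assoc (desc 0 k) (asc 1 j ++ [ suc j ]) [ suc j ])
                                                       (cong (desc 0 k ++_) (++-assoc (asc 1 j) [ suc j ] [ suc j ]))) ⟩
       desc 0 k ++ (asc 1 j ++ (suc j ∷ suc j ∷ [])) ≈⟨ ∼-++⁺ˡ (desc 0 k) (∼-++⁺ˡ (asc 1 j) (involutionℕ (suc j))) ⟩
       desc 0 k ++ (asc 1 j ++ [])                 ≡⟨ cong (desc 0 k ++_) (++-identityʳ (asc 1 j)) ⟩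
       desc 0 k ++ asc 1 j  ∎))
    where open ∼-Reasoning
  ... | tri> _ _ 1+j<i with m≤n⇒m<n∨m≡n 1+j<i
  ...   | inj₂ refl = extend (subst (_< k + k) (+-suc k (suc j)) (+-monoʳ-< k i<k))
            (trans (cong (_++ [ suc (suc j) ]) (coset-long k (suc j)))
              (trans (++-assoc (desc 0 k) (asc 1 (suc j)) [ suc (suc j) ])
                (trans (cong (desc 0 k ++_) (asc-∷ʳ 1 (suc j)))
                  (sym (trans (cong (coset k) (sym (+-suc k (suc j)))) (coset-long k (suc (suc j))))))))
  push-long k j (suc i) 1+j<k i<k k≤n | tri> _ _ 1+j<i | inj₁ 2+j<i with ≤-offset (suc (suc i)) k i<k
  ... | b , refl = push-long-braid₃ b i j (≤-pred 2+j<i) k≤n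
  push-long (suc (suc k2)) j zero 1+j<k i<k k≤n | tri< _ _ _ = push-long-braid₄ k2 j 1+j<k k≤n
  push-long (suc zero) j zero (s≤s ()) i<k k≤n | tri< _ _ _
  push-long k j (suc i1) 1+j<k i<k k≤n | tri< i<1+j _ _ with ≤-offset (suc (suc (suc i1))) k (≤-trans (s≤s i<1+j) 1+j<k)
  ... | b , refl with ≤-offset (suc (suc i1)) (suc j) i<1+j
  ... | c , e = subst (λ z → Push (b + suc (suc (suc i1))) ((b + suc (suc (suc i1))) + z) (suc i1)) (sym 1+j≡i+2+c)
                 (push-long-double-braid₃ b c i1 (subst (_< b + suc (suc (suc i1))) 1+j≡i+2+c 1+j<k) k≤n)
    where
    1+j≡i+2+c : suc j ≡ i1 + suc (suc c)
    1+j≡i+2+c = trans e (trans (+-comm c (suc (suc i1))) (sym (trans (+-suc i1 (suc c)) (cong suc (+-suc i1 c)))))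

  push-coset : ∀ k r i → r < k + k → i < k → k ≤ n → Push k r i
  push-coset k r i r<2k i<k k≤n with cosetView k r
  ... | short m refl = push-short m r i i<k k≤n
  ... | long j refl = push-long k j i (+-cancelˡ-< k (suc j) k r<2k) i<k k≤n

  PushedCode : List ℕ → ℕ → Set
  PushedCode d i = ∃ λ d′ → Code d′ × length d′ ≡ length d × (nf d ++ [ i ]) ∼ nf d′ × length (nf d′) ≤ suc (length (nf d))

  push-code : ∀ d i → Code d → i < length d → length d ≤ n → PushedCode d i
  push-code (r ∷ rest) i (r<2k , code) i<k k≤n with push-coset (suc (length rest)) r i r<2k i<k k≤n
  ... | extend 1+r<2k coset≡ =
    suc r ∷ rest , (1+r<2k , code) , refl ,
    ∼-reflexive (trans (++-assoc (nf rest) (coset (suc (length rest)) r) [ i ]) (cong (nf rest ++_) coset≡)) ,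
    ≤-reflexive (trans (length-nf (suc r) rest) (trans (+-suc _ r) (cong suc (sym (length-nf r rest)))))
  ... | cancel r′ refl p =
    r′ ∷ rest , (<-trans (n<1+n r′) r<2k , code) , refl ,
    ∼-trans (∼-reflexive (++-assoc (nf rest) (coset (suc (length rest)) (suc r′)) [ i ])) (∼-++⁺ˡ (nf rest) p) ,
    ≤-trans (≤-reflexive (length-nf r′ rest))
            (≤-trans (+-monoʳ-≤ (length (nf rest)) (≤-trans (n≤1+n r′) (n≤1+n (suc r′))))
                     (≤-reflexive (trans (+-suc _ (suc r′)) (cong suc (sym (length-nf (suc r′) rest))))))
  ... | pass i′ 1+i′<k p with push-code rest i′ code (≤-pred 1+i′<k) (≤-trans (n≤1+n _) k≤n)
  ...   | rest′ , code′ , rest′≡ , q , bound =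
    r ∷ rest′ , (subst (λ l → r < suc l + suc l) (sym rest′≡) r<2k , code′) , cong suc rest′≡ , chain ,
    ≤-trans (≤-reflexive (length-nf r rest′)) (≤-trans (+-monoˡ-≤ r bound) (≤-reflexive (cong suc (sym (length-nf r rest)))))
    where
    open ∼-Reasoning
    k = suc (length rest)
    chain : (nf (r ∷ rest) ++ [ i ]) ∼ nf (r ∷ rest′)
    chain = begin
      (nf rest ++ coset k r) ++ [ i ]          ≡⟨ ++-assoc (nf rest) (coset k r) [ i ] ⟩
      nf rest ++ (coset k r ++ [ i ])          ≈⟨ ∼-++⁺ˡ (nf rest) p ⟩
      nf rest ++ (i′ ∷ coset k r)              ≡⟨ ++-assoc (nf rest) [ i′ ] (coset k r) ⟨
      (nf rest ++ [ i′ ]) ++ coset k r         ≈⟨ ∼-++⁺ʳ (coset k r) q ⟩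
      nf rest′ ++ coset k r                    ≡⟨ cong (λ l → nf rest′ ++ coset (suc l) r) (sym rest′≡) ⟩
      nf rest′ ++ coset (suc (length rest′)) r ∎

  absorb-word : ∀ (a : Word n) d → Code d → length d ≡ n →
    ∃ λ d′ → Code d′ × length d′ ≡ n × (⟦ nf d ⟧ ++ a) ≈ ⟦ nf d′ ⟧ × length (nf d′) ≤ length (nf d) + length a
  absorb-word [] d code d≡n = d , code , d≡n , ≈-subst (sym (++-identityʳ ⟦ nf d ⟧)) refl ≈refl , m≤m+n _ 0
  absorb-word (c ∷ a) d code d≡n
    with push-code d (toℕ c) code (subst (toℕ c <_) (sym d≡n) (toℕ<n c)) (≤-reflexive d≡n)
  ... | d₁ , code₁ , d₁≡d , ⟨ q ⟩ , bound₁ with absorb-word a d₁ code₁ (trans d₁≡d d≡n)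
  ...   | d′ , code′ , d′≡n , q′ , bound′ =
    d′ , code′ , d′≡n ,
    ≈trans (≈-subst (++-assoc ⟦ nf d ⟧ [ c ] a) refl
              (≈-++⁺ʳ a (≈-subst (trans (map-++ letter (nf d) [ toℕ c ]) (cong (λ z → ⟦ nf d ⟧ ++ [ z ]) (letter-toℕ c))) refl q)))
           q′ ,
    ≤-trans bound′ (≤-trans (+-monoˡ-≤ (length a) bound₁) (≤-reflexive (sym (+-suc _ (length a)))))

  nf-zeros : ∀ k → nf (replicate k 0) ≡ []
  nf-zeros zero = refl
  nf-zeros (suc k) = trans (++-identityʳ (nf (replicate k 0))) (nf-zeros k)

  Code-zeros : ∀ k → Code (replicate k 0)
  Code-zeros zero = tt
  Code-zeros (suc k) = s≤s z≤n , Code-zeros k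

  normal-form : ∀ (a : Word n) → ∃ λ d → Code d × length d ≡ n × a ≈ ⟦ nf d ⟧ × length (nf d) ≤ length a
  normal-form a with absorb-word a (replicate n 0) (Code-zeros n) (length-replicate n)
  ... | d , code , d≡n , a≈nf , bound =
    d , code , d≡n , ≈-subst (cong (λ z → ⟦ z ⟧ ++ a) (nf-zeros n)) refl a≈nf ,
    subst (λ z → length (nf d) ≤ length z + length a) (nf-zeros n) bound

  pass-through-desc : ∀ i k → 1 ≤ i → suc i < k → k ≤ n → (i ∷ desc 0 k) ∼ (desc 0 k ++ [ suc i ])
  pass-through-desc i k 1≤i 1+i<k k≤n with ≤-offset (suc (suc i)) k 1+i<k
  ... | b , refl = subst (λ z → (i ∷ z) ∼ (z ++ [ suc i ])) (sym (desc-+ 0 b (suc (suc i)))) chain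
    where
    open ∼-Reasoning
    s = suc i
    A = desc (suc s) b
    B = desc 0 i
    s<k : s < b + suc (suc i)
    s<k = m≤n+m (suc (suc i)) b
    <k⇒<n : ∀ x → x < b + suc (suc i) → x < n
    <k⇒<n x x<k = <-≤-trans x<k k≤n
    A<n : All (_< n) A
    A<n = All-desc _ (suc s) b (λ x _ x<A → <k⇒<n x (subst (x <_) (+-comm (suc s) b) x<A))
    B<n : All (_< n) B
    B<n = All-desc _ 0 i (λ x _ x<i → <k⇒<n x (<-trans x<i (<-trans (n<1+n i) s<k)))
    chain : (i ∷ (A ++ (s ∷ i ∷ B))) ∼ ((A ++ (s ∷ i ∷ B)) ++ [ s ])
    chain = begin
      (i ∷ A) ++ (s ∷ i ∷ B)       ≈⟨ ∼-++⁺ʳ (s ∷ i ∷ B) (commute-past i A (<k⇒<n i (<-trans (n<1+n i) s<k)) A<n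
                                                                   (All-desc _ (suc s) b (λ x s<x _ → inj₁ s<x))) ⟨
      (A ++ [ i ]) ++ (s ∷ i ∷ B)  ≡⟨ ++-assoc A [ i ] (s ∷ i ∷ B) ⟩
      A ++ (i ∷ s ∷ i ∷ B)         ≈⟨ ∼-inside A B (braid₃ℕ i 1≤i (<k⇒<n s s<k)) ⟩
      A ++ (s ∷ i ∷ s ∷ B)         ≈⟨ ∼-++⁺ˡ A (∼-++⁺ˡ (s ∷ i ∷ []) (commute-past s B (<k⇒<n s s<k) B<n
                                                                   (All-desc _ 0 i (λ x _ x<i → inj₂ (s≤s x<i))))) ⟨
      A ++ (s ∷ i ∷ (B ++ [ s ]))  ≡⟨ ++-assoc A (s ∷ i ∷ B) [ s ] ⟨
      (A ++ (s ∷ i ∷ B)) ++ [ s ]  ∎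

  HasDescent : List ℕ → Set
  HasDescent d = ∃₂ λ i u → 1 ≤ i × i < length d × nf d ∼ (u ++ [ i ]) × suc (length u) ≡ length (nf d)

  ZeroOrFull⊎HasDescent : ∀ d → Code d → length d ≤ n → ZeroOrFull d ⊎ HasDescent d
  ZeroOrFull⊎HasDescent [] _ _ = inj₁ tt
  ZeroOrFull⊎HasDescent (r ∷ rest) (r<2k , code) k≤n with r ≟ 0 | r ≟ suc (length rest)
  ... | yes refl | _ with ZeroOrFull⊎HasDescent rest code (≤-trans (n≤1+n _) k≤n)
  ...   | inj₁ zf = inj₁ (inj₁ refl , zf)
  ...   | inj₂ (i , u , 1≤i , i<k , nf∼ , u≡) =
    inj₂ (i , u , 1≤i , <-trans i<k (n<1+n _) , ∼-trans (∼-reflexive (++-identityʳ (nf rest))) nf∼ ,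
          trans u≡ (cong length (sym (++-identityʳ (nf rest)))))
  ZeroOrFull⊎HasDescent (r ∷ rest) (r<2k , code) k≤n | no _ | yes refl with ZeroOrFull⊎HasDescent rest code (≤-trans (n≤1+n _) k≤n)
  ...   | inj₁ zf = inj₁ (inj₂ refl , zf)
  ...   | inj₂ (i , u , 1≤i , i<k , nf∼ , u≡) = inj₂ (suc i , u ++ desc 0 k , s≤s z≤n , s≤s i<k , chain , length≡)
    where
    open ∼-Reasoning
    k = suc (length rest)
    chain : nf (k ∷ rest) ∼ ((u ++ desc 0 k) ++ [ suc i ])
    chain = begin
      nf rest ++ coset k k          ≡⟨ cong (nf rest ++_) (coset-short 0 k) ⟩
      nf rest ++ desc 0 k           ≈⟨ ∼-++⁺ʳ (desc 0 k) nf∼ ⟩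
      (u ++ [ i ]) ++ desc 0 k      ≡⟨ ++-assoc u [ i ] (desc 0 k) ⟩
      u ++ (i ∷ desc 0 k)           ≈⟨ ∼-++⁺ˡ u (pass-through-desc i k 1≤i (s≤s i<k) k≤n) ⟩
      u ++ (desc 0 k ++ [ suc i ])  ≡⟨ ++-assoc u (desc 0 k) [ suc i ] ⟨
      (u ++ desc 0 k) ++ [ suc i ]  ∎
    length≡ : suc (length (u ++ desc 0 k)) ≡ length (nf (k ∷ rest))
    length≡ = trans (cong suc (trans (length-++ u) (cong (length u +_) (length-desc 0 k))))
                    (trans (cong (_+ k) u≡) (sym (length-nf k rest)))
  ZeroOrFull⊎HasDescent (r ∷ rest) (r<2k , code) k≤n | no r≢0 | no r≢k
    with coset-ends-in-descent (suc (length rest)) r r<2k r≢0 r≢k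
  ... | e , 1≤e , e<k , r′ , refl , coset≡ =
    inj₂ (e , nf rest ++ coset k r′ , 1≤e , e<k ,
          ∼-reflexive (trans (cong (nf rest ++_) coset≡) (sym (++-assoc (nf rest) (coset k r′) [ e ]))) ,
          trans (cong suc (trans (length-++ (nf rest)) (cong (length (nf rest) +_) (length-coset k r′))))
                (trans (sym (+-suc _ r′)) (sym (length-nf (suc r′) rest))))
    where k = suc (length rest)

  nf≡wSet : ∀ d → Code d → (d≡n : length d ≡ n) → ZeroOrFull d →
    ⟦ nf d ⟧ ≡ wSet (subsetOf (fullFlags d) (trans (length-fullFlags d) d≡n))
  nf≡wSet d code d≡n zf = map-injective toℕ-injective (begin
    map toℕ ⟦ nf d ⟧                                ≡⟨ map-toℕ-⟦⟧ (nf d) (subst (λ k → All (_< k) (nf d)) d≡n (nf-letters d code)) ⟩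
    nf d                                            ≡⟨ nf-ZeroOrFull d zf ⟩
    wℕ (truePositions (fullFlags d))                ≡⟨ cong (wℕ ∘ truePositions) (toList-subsetOf (fullFlags d) (trans (length-fullFlags d) d≡n)) ⟨
    wℕ (truePositions (toList G))                   ≡⟨ cong wℕ (positions≡truePositions G) ⟨
    wℕ (positions G)                                ≡⟨ map-toℕ-wSet G ⟨
    map toℕ (wSet G)                                ∎)
    where
    open ≡-Reasoning
    G = subsetOf (fullFlags d) (trans (length-fullFlags d) d≡n)

  nf-letters<n : ∀ d → Code d → length d ≡ n → All (_< n) (nf d)
  nf-letters<n d code d≡n = subst (λ k → All (_< k) (nf d)) d≡n (nf-letters d code)

  -- Acting on the list of distinctly labelled positive entries separates normal forms.
  nf-injective : ∀ d d′ → Code d → Code d′ → length d ≡ n → length d′ ≡ n → ⟦ nf d ⟧ ≈ ⟦ nf d′ ⟧ → d ≡ d′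
  nf-injective d d′ code code′ d≡n d′≡n nf≈nf′ =
    act-nf-injective d d′ y code code′ (trans d≡n (sym d′≡n)) (≤-reflexive (trans d≡n (sym (length-initial 0 n)))) (Distinct-initial 0 n)
      (begin
        Label.actℕ (nf d) y                  ≡⟨ cong (λ w → Label.actℕ w y) (map-toℕ-⟦⟧ (nf d) (nf-letters<n d code d≡n)) ⟨
        Label.act ⟦ nf d ⟧ y                 ≡⟨ Label.≈⇒act≡ flipSign-involutive nf≈nf′ y (length-initial 0 n) ⟩
        Label.act ⟦ nf d′ ⟧ y                ≡⟨ cong (λ w → Label.actℕ w y) (map-toℕ-⟦⟧ (nf d′) (nf-letters<n d′ code′ d′≡n)) ⟩
        Label.actℕ (nf d′) y                 ∎)
    where
    open ≡-Reasoning
    y = initial 0 n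

  HasLength-nf : ∀ (a : Word n) → ∃ λ d → Code d × length d ≡ n × a ≈ ⟦ nf d ⟧ × HasLength a (length (nf d))
  HasLength-nf a with normal-form a
  ... | d , code , d≡n , a≈nf , _ = d , code , d≡n , a≈nf , ((⟦ nf d ⟧ , ≈sym a≈nf , length-map letter (nf d)) , minimal)
    where
    minimal : ∀ b → b ≈ a → length (nf d) ≤ length b
    minimal b b≈a with normal-form b
    ... | d′ , code′ , d′≡n , b≈nf′ , nf′≤b =
      subst (λ z → length (nf z) ≤ length b) (nf-injective d′ d code′ code d′≡n d≡n (≈trans (≈sym b≈nf′) (≈trans b≈a a≈nf))) nf′≤b

  -- An element of the quotient has no descent s_i with i ≥ 1, so its code is ZeroOrFull, i.e. it is some w_G.
  InQuot⇒∃≈α-suc : ∀ (w : Word n) → InQuot w → ∃ λ I → w ≈ α I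
  InQuot⇒∃≈α-suc w w∈quot with HasLength-nf w
  ... | d , code , d≡n , w≈nf , ℓ-w with ZeroOrFull⊎HasDescent d code (≤-reflexive d≡n)
  ...   | inj₁ zf = g G , ≈trans w≈nf (≈-subst refl (trans (nf≡wSet d code d≡n zf) (cong wSet (sym (g-involutive G)))) ≈refl)
    where G = subsetOf (fullFlags d) (trans (length-fullFlags d) d≡n)
  ...   | inj₂ (i , u , 1≤i , i<d , ⟨ nf≈ui ⟩ , 1+u≡nf) with HasLength-nf (w ++ [ letter i ])
  ...     | d′ , _ , _ , _ , ℓ-wi = ⊥-elim (<-irrefl refl (begin-strict
    length (nf d)              <⟨ w∈quot (letter i) (subst (1 ≤_) (sym (toℕ-letter i<n)) 1≤i) _ _ ℓ-w ℓ-wi ⟩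
    length (nf d′)             ≤⟨ proj₂ ℓ-wi ⟦ u ⟧ u≈wi ⟩
    length ⟦ u ⟧               ≡⟨ length-map letter u ⟩
    length u                   <⟨ ≤-reflexive 1+u≡nf ⟩
    length (nf d)              ∎))
    where
    open ≤-Reasoning
    i<n : i < n
    i<n = subst (i <_) d≡n i<d
    u≈wi : ⟦ u ⟧ ≈ (w ++ [ letter i ])
    u≈wi = ≈sym (≈trans (≈-++⁺ʳ [ letter i ] (≈trans w≈nf nf≈ui))
                 (≈-subst (sym (trans (cong (_++ [ letter i ]) (map-++ letter u [ i ])) (++-assoc ⟦ u ⟧ [ letter i ] [ letter i ])))
                          (++-identityʳ ⟦ u ⟧)
                          (≈-++⁺ˡ ⟦ u ⟧ (involution (letter i)))))

InQuot⇒∃≈α : ∀ n (w : Word n) → InQuot w → ∃ λ I → w ≈ α I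
InQuot⇒∃≈α zero [] _ = [] , ≈refl
InQuot⇒∃≈α (suc n₀) w w∈quot = InQuot⇒∃≈α-suc n₀ w w∈quot

proposition6p7 : (n : ℕ) →
    ((I : Subset n) → InQuot (α I))
    × ((w : Word n) → InQuot w → ∃ λ I → w ≈ α I)
    × ((I J : Subset n) → α I ≈ α J → I ≡ J)
    × ((I J : Subset n) → (I ⊑ J → α I ≤B α J) × (α I ≤B α J → I ⊑ J))
proposition6p7 n =
  (λ I → Tight⇒InQuot (Tight-α I)) ,
  InQuot⇒∃≈α n ,
  α-injective ,
  (λ I J → ⊑⇒α≤B I J , α≤B⇒⊑ I J)
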